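{- Let $F=(F_1,F_2,\ldots,F_{\ell})$ be a suitable rooted forest-tuple, and let $B$ be a complete graph with $v(F)$ vertices, all edges initially free, in which distinct images of the roots of $F$ are fixed before the game. Then, playing the Waiter-Client game on $B$, Waiter can force a red copy $\bar F=\bar F_1 \cup \bar F_2 \cup \ldots \cup \bar F_{\ell}$ of $F_1 \cup F_2 \cup \ldots \cup F_{\ell}$ (with $\bar F_i$ the copy of $F_i$) within $e(F)+1$ rounds such that: (a) every root is mapped to its image fixed at the beginning; (b) no edges between the images of the roots are colored; (c) for every $i\in[\ell]$ there are no blue edges spanned by vertices in $V(\bar F_i)$; (d) for every $i\in[\ell]$ there are no red edges spanned by vertices in $V(\bar F_i)$ other than those of $\bar F_i$.
   Context: A rooted forest is a forest each of whose components contains exactly one distinguished vertex, its root. A rooted forest-tuple is a tuple $F=(F_1,\ldots,F_\ell)$ of pairwise vertex-disjoint rooted forests with $e(F_i)>0$ for some $i$; $v(F)=\sum_i v(F_i)$, $e(F)=\sum_i e(F_i)$. Let $a(F)=\max_i e(F_i)$, $k(F)=|\{i: e(F_i)=a(F)\}|$, $t(F)=|\{i: e(F_i)>0\}|$. $F$ is suitable if $3a(F)+k(F)-e(F)\le 2$, or if $a(F)=1$ and $t(F)\ge 4$. Waiter-Client game on a board $B$: in each round Waiter offers two free edges of $B$, Client colors one red (his) and the other becomes blue (Waiter's); Waiter forces a graph within $t$ rounds if she can ensure the red graph contains a copy of it after at most $t$ rounds. -}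

module Defs where

open import Data.Nat using (ℕ; zero; suc; _+_; _*_; _≤_; _<_; _⊔_)
open import Data.Fin using (Fin; zero; suc; _≟_)
open import Data.Bool using (Bool; true; false; _∧_; _∨_; if_then_else_)
open import Data.Maybe using (Maybe; just; nothing; is-just)
open import Data.Product using (Σ; ∃; _×_; _,_)
open import Data.Sum using (_⊎_)
open import Relation.Nullary using (¬_)
open import Relation.Nullary.Decidable using (⌊_⌋)
open import Relation.Binary.PropositionalEquality using (_≡_; _≢_)
open import Induction.WellFounded using (WellFounded)
open import Function.Definitions using (Injective)

count : ∀ {n} → (Fin n → Bool) → ℕ
count {zero}  p = 0
count {suc n} p = (if p zero then 1 else 0) + count (λ i → p (suc i))

sumF : ∀ {n} → (Fin n → ℕ) → ℕ
sumF {zero}  f = 0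
sumF {suc n} f = f zero + sumF (λ i → f (suc i))

maxF : ∀ {n} → (Fin n → ℕ) → ℕ
maxF {zero}  f = 0
maxF {suc n} f = f zero ⊔ maxF (λ i → f (suc i))

_==_ : ∀ {n} → Fin n → Fin n → Bool
i == j = ⌊ i ≟ j ⌋

_==ℕ_ : ℕ → ℕ → Bool
m ==ℕ n = ⌊ m Data.Nat.≟ n ⌋

-- The vertex set of F = (F_1,...,F_ℓ) is Fin n (so n = v(F)); vertex v
-- belongs to F_(part v).  A rooted forest is encoded by its parent map:
-- parent v = nothing iff v is a root, otherwise parent v = just w where
-- vw is the edge from v towards the root of its component.  The parent
-- relation is well-founded (no cycles), so every component is a tree
-- containing exactly one root.  Edges never leave a part, so each F_i
-- is itself a rooted forest and the F_i are pairwise vertex-disjoint.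

ParentRel : ∀ {n} → (Fin n → Maybe (Fin n)) → Fin n → Fin n → Set
ParentRel parent w v = parent v ≡ just w

record ForestTuple (n ℓ : ℕ) : Set where
  field
    part      : Fin n → Fin ℓ
    parent    : Fin n → Maybe (Fin n)
    acyclic   : WellFounded (ParentRel parent)
    samePart  : ∀ v w → parent v ≡ just w → part v ≡ part w
open ForestTuple public

module _ {n ℓ : ℕ} (F : ForestTuple n ℓ) where

  IsRoot : Fin n → Set
  IsRoot v = parent F v ≡ nothing

  IsEdge : Fin n → Fin n → Set
  IsEdge v w = parent F v ≡ just w ⊎ parent F w ≡ just v

  -- e(F_i): number of edges of F_i = number of non-root vertices in part i
  eᵢ : Fin ℓ → ℕ
  eᵢ i = count (λ v → (part F v == i) ∧ is-just (parent F v))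

  eF : ℕ
  eF = sumF eᵢ

  aF : ℕ
  aF = maxF eᵢ

  kF : ℕ
  kF = count (λ i → eᵢ i ==ℕ aF)

  tF : ℕ
  tF = count (λ i → Data.Bool.not (eᵢ i ==ℕ 0))

  -- 3a(F) + k(F) - e(F) ≤ 2 (integers), written without subtraction
  Suitable : Set
  Suitable = (3 * aF + kF ≤ 2 + eF) ⊎ (aF ≡ 1 × 4 ≤ tF)

-- Waiter-Client game on the complete graph K_n with vertex set Fin n.
-- A colouring gives each (ordered) pair a colour; it is kept symmetric.

data Colour : Set where
  free red blue : Colour

Colouring : ℕ → Set
Colouring n = Fin n → Fin n → Colour

initial : ∀ {n} → Colouring n
initial _ _ = free

paint : ∀ {n} → Colour → Fin n → Fin n → Colouring n → Colouring n
paint k u v c x y =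
  if ((x == u) ∧ (y == v)) ∨ ((x == v) ∧ (y == u)) then k else c x y

SameEdge : ∀ {n} → Fin n → Fin n → Fin n → Fin n → Set
SameEdge u₁ v₁ u₂ v₂ = (u₁ ≡ u₂ × v₁ ≡ v₂) ⊎ (u₁ ≡ v₂ × v₁ ≡ u₂)

-- Forces P t c : from colouring c, Waiter can ensure that within at most
-- t further rounds a colouring satisfying P is reached.  In each round
-- Waiter offers two distinct free edges {u₁,v₁}, {u₂,v₂}; Client colours
-- one red, the other becomes blue.
data Forces {n : ℕ} (P : Colouring n → Set) : ℕ → Colouring n → Set where
  done : ∀ {t c} → P c → Forces P t c
  step : ∀ {t c} (u₁ v₁ u₂ v₂ : Fin n) →
         u₁ ≢ v₁ → u₂ ≢ v₂ → ¬ SameEdge u₁ v₁ u₂ v₂ →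
         c u₁ v₁ ≡ free → c u₂ v₂ ≡ free →
         Forces P t (paint red u₁ v₁ (paint blue u₂ v₂ c)) →
         Forces P t (paint red u₂ v₂ (paint blue u₁ v₁ c)) →
         Forces P (suc t) c

Goal : ∀ {n ℓ} → ForestTuple n ℓ → (Fin n → Fin n) → Colouring n → Set
Goal {n} F ρ c = Σ (Fin n → Fin n) λ φ →
    Injective _≡_ _≡_ φ
  × (∀ v w → parent F v ≡ just w → c (φ v) (φ w) ≡ red)
  × (∀ r → IsRoot F r → φ r ≡ ρ r)
  × (∀ r r' → IsRoot F r → IsRoot F r' → r ≢ r' → c (ρ r) (ρ r') ≡ free)
  × (∀ x y → part F x ≡ part F y → c (φ x) (φ y) ≢ blue)
  × (∀ x y → part F x ≡ part F y → c (φ x) (φ y) ≡ red → IsEdge F x y)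

{-# OPTIONS --safe #-}
-- Waiter keeps an injective placement φ of all vertices of F on the board,
-- with every root at its prescribed image; a vertex is embedded once the edge
-- to its parent is red, and the places of the other vertices may still be
-- exchanged.  In a typical round Waiter offers the two edges joining one free
-- place to the (embedded) parents of pending vertices in two different parts,
-- and gives the place to whichever vertex Client's red edge belongs to.  So
-- blue edges never lie inside a part and red edges inside a part are tree
-- edges.  The parts offered are read off the numbers of remaining edges per
-- part, chosen so that both outcomes keep this vector suitable (after a
-- round forcing an edge of the unique largest part, if necessary); each edge
-- then costs one round.  In the two configurations where this is impossible,
-- one parent first receives red edges to two places and the choice of which
-- one becomes its child is postponed to the last round, which is the extra
-- round.
module Submission where

open import Defs
open import Data.Nat using (ℕ; suc; _<_)
open import Data.Fin using (Fin)
open import Relation.Binary.PropositionalEquality using (_≡_)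
open import Data.Nat using (zero; _+_; _*_; _≤_; _≰_; _⊔_; z≤n; s≤s; pred; _≤?_)
open import Data.Nat.Properties hiding (_≟_; 0≢1+n)
open import Data.Nat.Tactic.RingSolver using (solve-∀)
open import Data.Fin using (zero; suc; _≟_)
open import Data.Fin.Properties using (0≢1+n) renaming (suc-injective to fsuc-injective)
open import Data.Fin.Patterns using (0F; 1F; 2F; 3F)
open import Data.Fin.Permutation.Components using (transpose)
open import Data.Bool using (Bool; true; false; not; _∧_; if_then_else_)
open import Data.Bool.Properties using (∧-zeroʳ; ∨-comm; ∧-comm)
open import Data.Maybe using (just; nothing; is-just)
open import Data.Maybe.Properties using (just-injective)
open import Data.Product using (Σ; ∃; _×_; _,_; proj₁; proj₂)
open import Data.Sum using (_⊎_; inj₁; inj₂)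
open import Data.Empty using (⊥)
open import Data.List using (List; []; _∷_; allFin)
open import Data.List.Relation.Unary.Any using (here; there)
open import Data.List.Membership.Propositional using (_∉_)
open import Data.List.Membership.Propositional.Properties using (∈-allFin)
open import Data.Vec.Functional using (updateAt)
open import Data.Vec.Functional.Properties using (updateAt-updates; updateAt-minimal)
open import Function using (_∘_; id; const)
open import Induction.WellFounded using (Acc; acc; WfRec)
open import Data.Nat.Induction using (<-rec)
open import Relation.Binary.Construct.Union using (_∪_)
open import Relation.Nullary using (Dec; yes; no; ¬_; contradiction)
open import Relation.Nullary.Decidable using (⌊_⌋; isYes≗does; dec-true; dec-false; _×-dec_; _⊎-dec_)
open import Relation.Binary.PropositionalEquality
open import Relation.Unary using (Decidable)

module _ {A : Set} where

  ⌊⌋-true : (a? : Dec A) → A → ⌊ a? ⌋ ≡ true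
  ⌊⌋-true a? a = trans (isYes≗does a?) (dec-true a? a)

  ⌊⌋-false : (a? : Dec A) → ¬ A → ⌊ a? ⌋ ≡ false
  ⌊⌋-false a? ¬a = trans (isYes≗does a?) (dec-false a? ¬a)

  ⌊⌋-sound : (a? : Dec A) → ⌊ a? ⌋ ≡ true → A
  ⌊⌋-sound (yes a) _ = a

==-refl : ∀ {n} {i : Fin n} → (i == i) ≡ true
==-refl {i = i} = ⌊⌋-true (i ≟ i) refl

==ℕ-refl : ∀ {m} → (m ==ℕ m) ≡ true
==ℕ-refl {m} = ⌊⌋-true (m Data.Nat.≟ m) refl

module _ {n : ℕ} {i j : Fin n} where

  ==⇒≡ : (i == j) ≡ true → i ≡ j
  ==⇒≡ = ⌊⌋-sound (i ≟ j)

  ≢⇒==-false : i ≢ j → (i == j) ≡ false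
  ≢⇒==-false = ⌊⌋-false (i ≟ j)

module _ {m k : ℕ} where

  ==ℕ⇒≡ : (m ==ℕ k) ≡ true → m ≡ k
  ==ℕ⇒≡ = ⌊⌋-sound (m Data.Nat.≟ k)

  ≢⇒==ℕ-false : m ≢ k → (m ==ℕ k) ≡ false
  ≢⇒==ℕ-false = ⌊⌋-false (m Data.Nat.≟ k)

true≢false : true ≢ false
true≢false ()

sumF-cong : ∀ {n} {f g : Fin n → ℕ} → (∀ i → f i ≡ g i) → sumF f ≡ sumF g
sumF-cong {zero}  f≗g = refl
sumF-cong {suc n} f≗g = cong₂ _+_ (f≗g zero) (sumF-cong (λ i → f≗g (suc i)))

sumF-mono : ∀ {n} {f g : Fin n → ℕ} → (∀ i → f i ≤ g i) → sumF f ≤ sumF g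
sumF-mono {zero}  f≤g = z≤n
sumF-mono {suc n} f≤g = +-mono-≤ (f≤g zero) (sumF-mono (λ i → f≤g (suc i)))

sumF-0 : ∀ n → sumF {n} (const 0) ≡ 0
sumF-0 zero    = refl
sumF-0 (suc n) = sumF-0 n

-- Stated with both values added on opposite sides, so that no subtraction occurs.
sumF-agree-except : ∀ {n} (f g : Fin n → ℕ) (j : Fin n) →
  (∀ i → i ≢ j → f i ≡ g i) → sumF f + g j ≡ sumF g + f j
sumF-agree-except {suc n} f g zero f≗g
  rewrite sumF-cong {f = λ i → f (suc i)} {g = λ i → g (suc i)} (λ i → f≗g (suc i) λ ())
  = +-swap-ends (f zero) _ (g zero)
  where
    +-swap-ends : ∀ a s b → a + s + b ≡ b + s + a
    +-swap-ends = solve-∀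
sumF-agree-except {suc n} f g (suc j) f≗g rewrite f≗g zero (λ ()) = begin
  g zero + sumF (λ i → f (suc i)) + g (suc j)   ≡⟨ +-assoc (g zero) _ _ ⟩
  g zero + (sumF (λ i → f (suc i)) + g (suc j)) ≡⟨ cong (g zero +_) IH ⟩
  g zero + (sumF (λ i → g (suc i)) + f (suc j)) ≡⟨ +-assoc (g zero) _ _ ⟨
  g zero + sumF (λ i → g (suc i)) + f (suc j)   ∎
  where
    open ≡-Reasoning
    IH = sumF-agree-except (λ i → f (suc i)) (λ i → g (suc i)) j
           (λ i i≢j → f≗g (suc i) (λ e → i≢j (fsuc-injective e)))

sumF-updateAt : ∀ {n} (f : Fin n → ℕ) (j : Fin n) (h : ℕ → ℕ) →
  sumF (updateAt f j h) + f j ≡ sumF f + h (f j)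
sumF-updateAt f j h =
  subst (λ x → sumF (updateAt f j h) + f j ≡ sumF f + x) (updateAt-updates j f)
    (sumF-agree-except (updateAt f j h) f j (λ i i≢j → updateAt-minimal i j f i≢j))

f≤sumF : ∀ {n} (f : Fin n → ℕ) (i : Fin n) → f i ≤ sumF f
f≤sumF {suc n} f zero    = m≤m+n _ _
f≤sumF {suc n} f (suc i) = ≤-trans (f≤sumF (λ j → f (suc j)) i) (m≤n+m _ (f zero))

sumF-split : ∀ {n} (f : Fin n → ℕ) (i : Fin n) → sumF f ≡ f i + sumF (updateAt f i (const 0))
sumF-split f i = begin
  sumF f                                  ≡⟨ +-identityʳ (sumF f) ⟨
  sumF f + 0                              ≡⟨ sumF-updateAt f i (const 0) ⟨
  sumF (updateAt f i (const 0)) + f i     ≡⟨ +-comm _ (f i) ⟩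
  f i + sumF (updateAt f i (const 0))     ∎
  where open ≡-Reasoning

f+f≤sumF : ∀ {n} (f : Fin n → ℕ) {i j} → i ≢ j → f i + f j ≤ sumF f
f+f≤sumF f {i} {j} i≢j = begin
  f i + f j                                 ≡⟨ cong (f i +_) (updateAt-minimal j i f (λ e → i≢j (sym e))) ⟨
  f i + updateAt f i (const 0) j            ≤⟨ +-monoʳ-≤ (f i) (f≤sumF _ j) ⟩
  f i + sumF (updateAt f i (const 0))       ≡⟨ sumF-split f i ⟨
  sumF f                                    ∎
  where open ≤-Reasoning

f+f+f≤sumF : ∀ {n} (f : Fin n → ℕ) {i j k} → i ≢ j → i ≢ k → j ≢ k → f i + f j + f k ≤ sumF f
f+f+f≤sumF f {i} {j} {k} i≢j i≢k j≢k = begin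
  f i + f j + f k                           ≡⟨ +-assoc (f i) _ _ ⟩
  f i + (f j + f k)                         ≡⟨ cong (f i +_) (cong₂ _+_ (f₀≡f j i≢j) (f₀≡f k i≢k)) ⟨
  f i + (f₀ j + f₀ k)                       ≤⟨ +-monoʳ-≤ (f i) (f+f≤sumF f₀ j≢k) ⟩
  f i + sumF f₀                             ≡⟨ sumF-split f i ⟨
  sumF f                                    ∎
  where
    open ≤-Reasoning
    f₀ = updateAt f i (const 0)
    f₀≡f : ∀ x → i ≢ x → f₀ x ≡ f x
    f₀≡f x i≢x = updateAt-minimal x i f (λ e → i≢x (sym e))

⟦_⟧ : Bool → ℕ
⟦ b ⟧ = if b then 1 else 0

sumF-indicator : ∀ {n} (p : Fin n → Bool) (b : ℕ) → sumF (λ i → if p i then b else 0) ≡ b * count p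
sumF-indicator {zero}  p b = sym (*-zeroʳ b)
sumF-indicator {suc n} p b with p zero
... | true  = trans (cong (b +_) (sumF-indicator (λ i → p (suc i)) b)) (sym (*-suc b _))
... | false = sumF-indicator (λ i → p (suc i)) b

count≡sumF : ∀ {n} (p : Fin n → Bool) → count p ≡ sumF (λ i → ⟦ p i ⟧)
count≡sumF p = sym (trans (sumF-indicator p 1) (*-identityˡ (count p)))

count-cong : ∀ {n} {p q : Fin n → Bool} → (∀ i → p i ≡ q i) → count p ≡ count q
count-cong {p = p} {q} p≗q =
  trans (count≡sumF p) (trans (sumF-cong (λ i → cong ⟦_⟧ (p≗q i))) (sym (count≡sumF q)))

count-mono : ∀ {n} {p q : Fin n → Bool} → (∀ i → p i ≡ true → q i ≡ true) → count p ≤ count q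
count-mono {p = p} {q} p⊆q =
  subst₂ _≤_ (sym (count≡sumF p)) (sym (count≡sumF q)) (sumF-mono indicator-mono)
  where
    indicator-mono : ∀ i → ⟦ p i ⟧ ≤ ⟦ q i ⟧
    indicator-mono i with p i | q i | p⊆q i
    ... | false | _     | _   = z≤n
    ... | true  | true  | _   = ≤-refl
    ... | true  | false | p→q = contradiction (p→q refl) λ ()

count-agree-except : ∀ {n} (p q : Fin n → Bool) (j : Fin n) → (∀ i → i ≢ j → p i ≡ q i) →
  count p + ⟦ q j ⟧ ≡ count q + ⟦ p j ⟧
count-agree-except p q j p≗q =
  subst₂ (λ x y → x + ⟦ q j ⟧ ≡ y + ⟦ p j ⟧)
    (sym (count≡sumF p)) (sym (count≡sumF q))
    (sumF-agree-except _ _ j (λ i i≢j → cong ⟦_⟧ (p≗q i i≢j)))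

remove : ∀ {n} → (Fin n → Bool) → Fin n → (Fin n → Bool)
remove p i = updateAt p i (const false)

remove-at : ∀ {n} (p : Fin n → Bool) (i : Fin n) → remove p i i ≡ false
remove-at p i = updateAt-updates i p

remove-other : ∀ {n} (p : Fin n → Bool) {i j : Fin n} → j ≢ i → remove p i j ≡ p j
remove-other p {i} {j} = updateAt-minimal j i p

remove-false : ∀ {n} (p : Fin n → Bool) (i : Fin n) {j} → p j ≡ false → remove p i j ≡ false
remove-false p i {j} pj with j ≟ i
... | yes refl = remove-at p i
... | no j≢i   = trans (remove-other p j≢i) pj

remove-sound : ∀ {n} (p : Fin n → Bool) (i : Fin n) {j} → remove p i j ≡ true → p j ≡ true × j ≢ i
remove-sound p i {j} e with j ≟ i
... | yes refl = contradiction (trans (sym e) (remove-at p i)) true≢false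
... | no j≢i   = trans (sym (remove-other p j≢i)) e , j≢i

remove-false-view : ∀ {n} (p : Fin n → Bool) (i : Fin n) {j} → remove p i j ≡ false → j ≡ i ⊎ p j ≡ false
remove-false-view p i {j} e with j ≟ i
... | yes j≡i = inj₁ j≡i
... | no j≢i   = inj₂ (trans (sym (remove-other p j≢i)) e)

count-remove : ∀ {n} (p : Fin n → Bool) (i : Fin n) → p i ≡ true → suc (count (remove p i)) ≡ count p
count-remove p i pi with count-agree-except (remove p i) p i (λ j → remove-other p)
... | e rewrite pi | remove-at p i = trans (+-comm 1 _) (trans e (+-identityʳ _))

count-∧-remove : ∀ {n} (q p : Fin n → Bool) (i : Fin n) →
  count (λ j → q j ∧ remove p i j) + ⟦ q i ∧ p i ⟧ ≡ count (λ j → q j ∧ p j)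
count-∧-remove q p i = begin
  count (λ j → q j ∧ remove p i j) + ⟦ q i ∧ p i ⟧    ≡⟨ count-agree-except _ _ i agree ⟩
  count (λ j → q j ∧ p j) + ⟦ q i ∧ remove p i i ⟧    ≡⟨ cong (λ b → count (λ j → q j ∧ p j) + ⟦ q i ∧ b ⟧) (remove-at p i) ⟩
  count (λ j → q j ∧ p j) + ⟦ q i ∧ false ⟧            ≡⟨ cong (λ b → count (λ j → q j ∧ p j) + ⟦ b ⟧) (∧-zeroʳ (q i)) ⟩
  count (λ j → q j ∧ p j) + 0                          ≡⟨ +-identityʳ _ ⟩
  count (λ j → q j ∧ p j)                              ∎
  where
    open ≡-Reasoning
    agree : ∀ j → j ≢ i → (q j ∧ remove p i j) ≡ (q j ∧ p j)
    agree j j≢i = cong (q j ∧_) (remove-other p j≢i)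

count-pos : ∀ {n} (p : Fin n → Bool) {i : Fin n} → p i ≡ true → 1 ≤ count p
count-pos p {i} pi = subst (1 ≤_) (count-remove p i pi) (s≤s z≤n)

count-witness : ∀ {n} (p : Fin n → Bool) → 1 ≤ count p → ∃ λ i → p i ≡ true
count-witness {suc n} p h with p zero in p0
... | true  = zero , p0
... | false with count-witness (λ i → p (suc i)) h
...   | i , pi = suc i , pi

count-unique : ∀ {n} (p : Fin n → Bool) → count p ≤ 1 → ∀ {i j} → p i ≡ true → p j ≡ true → i ≡ j
count-unique p h {i} {j} pi pj with j ≟ i
... | yes j≡i = sym j≡i
... | no j≢i  = contradiction h (<⇒≱ (begin-strict
      1                       ≤⟨ count-pos (remove p i) (trans (remove-other p j≢i) pj) ⟩
      count (remove p i)      <⟨ n<1+n _ ⟩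
      suc (count (remove p i)) ≡⟨ count-remove p i pi ⟩
      count p                 ∎))
  where open ≤-Reasoning

count-witnesses : ∀ {n} (p : Fin n → Bool) k → k ≤ count p →
  Σ (Fin k → Fin n) λ w → (∀ {x y} → w x ≡ w y → x ≡ y) × (∀ x → p (w x) ≡ true)
count-witnesses p zero    _ = (λ ()) , (λ { {()} }) , λ ()
count-witnesses p (suc k) h with count-witness p (≤-trans (s≤s z≤n) h)
... | i , pi with count-witnesses (remove p i) k (≤-pred (subst (suc k ≤_) (sym (count-remove p i pi)) h))
... | w , w-inj , pw = i∷w , inj , sat
  where
    i∷w : Fin (suc k) → Fin _
    i∷w zero    = i
    i∷w (suc x) = w x
    w≢i : ∀ x → w x ≢ i
    w≢i x = proj₂ (remove-sound p i (pw x))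
    inj : ∀ {x y} → i∷w x ≡ i∷w y → x ≡ y
    inj {zero}  {zero}  _ = refl
    inj {zero}  {suc y} e = contradiction (sym e) (w≢i y)
    inj {suc x} {zero}  e = contradiction e (w≢i x)
    inj {suc x} {suc y} e = cong suc (w-inj e)
    sat : ∀ x → p (i∷w x) ≡ true
    sat zero    = pi
    sat (suc x) = proj₁ (remove-sound p i (pw x))

maxF-upper : ∀ {n} (f : Fin n → ℕ) (i : Fin n) → f i ≤ maxF f
maxF-upper {suc n} f zero    = m≤m⊔n _ _
maxF-upper {suc n} f (suc i) = ≤-trans (maxF-upper (λ j → f (suc j)) i) (m≤n⊔m (f zero) _)

maxF-least : ∀ {n} (f : Fin n → ℕ) {b : ℕ} → (∀ i → f i ≤ b) → maxF f ≤ b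
maxF-least {zero}  f f≤b = z≤n
maxF-least {suc n} f f≤b = ⊔-lub (f≤b zero) (maxF-least (λ j → f (suc j)) (λ i → f≤b (suc i)))

maxF-attained : ∀ {n} (f : Fin n → ℕ) → 1 ≤ maxF f → ∃ λ i → f i ≡ maxF f
maxF-attained {suc n} f h with ⊔-sel (f zero) (maxF (λ j → f (suc j)))
... | inj₁ e = zero , sym e
... | inj₂ e with maxF-attained (λ j → f (suc j)) (subst (1 ≤_) e h)
...   | i , fi = suc i , trans fi (sym e)

maxF-unique : ∀ {n} (f : Fin n → ℕ) {b : ℕ} {j : Fin n} → (∀ i → f i ≤ b) → f j ≡ b → maxF f ≡ b
maxF-unique f {j = j} f≤b fj = ≤-antisym (maxF-least f f≤b) (subst (_≤ maxF f) fj (maxF-upper f j))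

maxF-cong : ∀ {n} {f g : Fin n → ℕ} → (∀ i → f i ≡ g i) → maxF f ≡ maxF g
maxF-cong {zero}  f≗g = refl
maxF-cong {suc n} f≗g = cong₂ _⊔_ (f≗g zero) (maxF-cong (λ i → f≗g (suc i)))

maxF-pos : ∀ {n} (f : Fin n → ℕ) → 1 ≤ sumF f → 1 ≤ maxF f
maxF-pos {n} f h with maxF f in max≡
... | suc _ = s≤s z≤n
... | zero  = contradiction (≤-trans h (≤-trans (sumF-mono all-zero) (≤-reflexive (sumF-0 n)))) λ ()
  where
    all-zero : ∀ i → f i ≤ 0
    all-zero i = subst (f i ≤_) max≡ (maxF-upper f i)

#max : ∀ {ℓ} → (Fin ℓ → ℕ) → ℕ
#max C = count (λ i → C i ==ℕ maxF C)

#nonzero : ∀ {ℓ} → (Fin ℓ → ℕ) → ℕ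
#nonzero C = count (λ i → not (C i ==ℕ 0))

-- For C = eᵢ F this is Suitable F, definitionally.
SuitableCounts : ∀ {ℓ} → (Fin ℓ → ℕ) → Set
SuitableCounts C = (3 * maxF C + #max C ≤ 2 + sumF C) ⊎ (maxF C ≡ 1 × 4 ≤ #nonzero C)

Suitable⁺ : ∀ {ℓ} → (Fin ℓ → ℕ) → Set
Suitable⁺ C = SuitableCounts C × 1 ≤ maxF C

Suitable⁺-cong : ∀ {ℓ} {C D : Fin ℓ → ℕ} → (∀ i → C i ≡ D i) → Suitable⁺ C → Suitable⁺ D
Suitable⁺-cong {C = C} {D} C≗D (s , a≥1) = suitable s , subst (1 ≤_) maxF≡ a≥1
  where
    maxF≡ = maxF-cong C≗D
    suitable : SuitableCounts C → SuitableCounts D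
    suitable (inj₁ h) = inj₁ (begin
      3 * maxF D + #max D ≡⟨ cong₂ (λ a k → 3 * a + k) maxF≡ (count-cong (λ i → cong₂ _==ℕ_ (C≗D i) maxF≡)) ⟨
      3 * maxF C + #max C ≤⟨ h ⟩
      2 + sumF C          ≡⟨ cong (2 +_) (sumF-cong C≗D) ⟩
      2 + sumF D          ∎)
      where open ≤-Reasoning
    suitable (inj₂ (a≡1 , t≥4)) =
      inj₂ (trans (sym maxF≡) a≡1 , subst (4 ≤_) (count-cong (λ i → cong (not ∘ (_==ℕ 0)) (C≗D i))) t≥4)

sumF≡#nonzero : ∀ {ℓ} (C : Fin ℓ → ℕ) → (∀ j → C j ≤ 1) → sumF C ≡ #nonzero C
sumF≡#nonzero C C≤1 = trans (sumF-cong 0/1) (sym (count≡sumF (λ j → not (C j ==ℕ 0))))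
  where
    0/1 : ∀ j → C j ≡ ⟦ not (C j ==ℕ 0) ⟧
    0/1 j with C j | C≤1 j
    ... | zero     | _ = refl
    ... | suc zero | _ = refl
    ... | suc (suc _) | s≤s ()

sumF≤*#nonzero : ∀ {ℓ} (C : Fin ℓ → ℕ) {b} → (∀ j → C j ≤ b) → sumF C ≤ b * #nonzero C
sumF≤*#nonzero C {b} C≤b = ≤-trans (sumF-mono bound) (≤-reflexive (sumF-indicator (λ j → not (C j ==ℕ 0)) b))
  where
    bound : ∀ j → C j ≤ (if not (C j ==ℕ 0) then b else 0)
    bound j with C j | C≤b j
    ... | zero  | _   = z≤n
    ... | suc _ | Cj≤b = Cj≤b

*#value≤sumF : ∀ {ℓ} (C : Fin ℓ → ℕ) b → b * count (λ j → C j ==ℕ b) ≤ sumF C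
*#value≤sumF C b = ≤-trans (≤-reflexive (sym (sumF-indicator (λ j → C j ==ℕ b) b))) (sumF-mono bound)
  where
    bound : ∀ j → (if C j ==ℕ b then b else 0) ≤ C j
    bound j with C j ==ℕ b in e
    ... | true  = ≤-reflexive (sym (==ℕ⇒≡ e))
    ... | false = z≤n

decrement : ∀ {ℓ} → (Fin ℓ → ℕ) → Fin ℓ → (Fin ℓ → ℕ)
decrement C i = updateAt C i pred

module _ {ℓ} (C : Fin ℓ → ℕ) (i : Fin ℓ) where

  decrement-at : decrement C i i ≡ pred (C i)
  decrement-at = updateAt-updates i C

  decrement-other : ∀ {j} → j ≢ i → decrement C i j ≡ C j
  decrement-other {j} = updateAt-minimal j i C

  decrement-≤ : ∀ j → decrement C i j ≤ C j
  decrement-≤ j with j ≟ i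
  ... | yes refl = ≤-trans (≤-reflexive decrement-at) (pred[n]≤n {C i})
  ... | no j≢i   = ≤-reflexive (decrement-other j≢i)

  sumF-decrement : 1 ≤ C i → suc (sumF (decrement C i)) ≡ sumF C
  sumF-decrement Ci≥1 = cancel-pred Ci≥1 (sumF-updateAt C i pred)
    where
      cancel-pred : ∀ {s t x} → 1 ≤ x → s + x ≡ t + pred x → suc s ≡ t
      cancel-pred {s} {t} {suc x} _ e = +-cancelʳ-≡ x _ _ (trans (sym (+-suc s x)) e)

  count-decrement : (P : ℕ → Bool) →
    count (λ j → P (decrement C i j)) + ⟦ P (C i) ⟧ ≡ count (λ j → P (C j)) + ⟦ P (pred (C i)) ⟧
  count-decrement P =
    subst (λ x → count (λ j → P (decrement C i j)) + ⟦ P (C i) ⟧ ≡ count (λ j → P (C j)) + ⟦ P x ⟧)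
      decrement-at (count-agree-except _ _ i (λ j j≢i → cong P (decrement-other j≢i)))

count-decrement-drop : ∀ {ℓ} (C : Fin ℓ → ℕ) (i : Fin ℓ) (P : ℕ → Bool) →
  P (C i) ≡ true → P (pred (C i)) ≡ false → count (λ j → P (decrement C i j)) + 1 ≡ count (λ j → P (C j))
count-decrement-drop C i P PCi Ppred with count-decrement C i P
... | e rewrite PCi | Ppred = trans e (+-identityʳ _)

count-decrement-gain : ∀ {ℓ} (C : Fin ℓ → ℕ) (i : Fin ℓ) (P : ℕ → Bool) →
  P (C i) ≡ false → P (pred (C i)) ≡ true → count (λ j → P (decrement C i j)) ≡ suc (count (λ j → P (C j)))
count-decrement-gain C i P PCi Ppred = begin
  after                          ≡⟨ +-identityʳ _ ⟨
  after + 0                      ≡⟨ cong (λ b → after + ⟦ b ⟧) PCi ⟨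
  after + ⟦ P (C i) ⟧            ≡⟨ count-decrement C i P ⟩
  before + ⟦ P (pred (C i)) ⟧    ≡⟨ cong (λ b → before + ⟦ b ⟧) Ppred ⟩
  before + 1                     ≡⟨ +-comm before 1 ⟩
  suc before                     ∎
  where
    open ≡-Reasoning
    before = count (λ j → P (C j))
    after  = count (λ j → P (decrement C i j))

decrement-cong : ∀ {ℓ} {C D : Fin ℓ → ℕ} → (∀ x → C x ≡ D x) → ∀ i j → decrement C i j ≡ decrement D i j
decrement-cong {C = C} {D} C≗D i j with j ≟ i
... | yes refl = trans (decrement-at C i) (trans (cong pred (C≗D i)) (sym (decrement-at D i)))
... | no j≢i   = trans (decrement-other C i j≢i) (trans (C≗D j) (sym (decrement-other D i j≢i)))

pred< : ∀ {x} → 1 ≤ x → pred x < x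
pred< {suc x} _ = ≤-refl

-- Waiter's next rounds, read off the numbers C of remaining edges per part:
-- in offerPair Client decides whether part i or part j loses an edge, in
-- forceThenOfferPair part i loses one first; the last two shapes are the
-- ones that need an extra round.
data Plan {ℓ} (C : Fin ℓ → ℕ) : Set where
  offerPair : ∀ i j → i ≢ j → 1 ≤ C i → 1 ≤ C j →
    Suitable⁺ (decrement C i) → Suitable⁺ (decrement C j) → Plan C
  forceThenOfferPair : ∀ i j₁ j₂ → i ≢ j₁ → i ≢ j₂ → j₁ ≢ j₂ → 1 ≤ C i → 1 ≤ C j₁ → 1 ≤ C j₂ →
    Suitable⁺ (decrement (decrement C i) j₁) → Suitable⁺ (decrement (decrement C i) j₂) → Plan C
  fourSingletons : (∀ j → C j ≤ 1) → sumF C ≡ 4 → Plan C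
  pairAndThreeSingletons : ∀ i → C i ≡ 2 → (∀ j → j ≢ i → C j ≤ 1) → sumF C ≡ 5 → Plan C

module SharedMax {ℓ} (C : Fin ℓ → ℕ) {i o : Fin ℓ} (i≢o : i ≢ o)
                 (Ci : C i ≡ maxF C) (Co : C o ≡ maxF C) (a≥1 : 1 ≤ maxF C) where

  private
    a = maxF C
    D = decrement C i

  maxF-D : maxF D ≡ a
  maxF-D = maxF-unique D (λ j → ≤-trans (decrement-≤ C i j) (maxF-upper C j))
                         (trans (decrement-other C i (λ o≡i → i≢o (sym o≡i))) Co)

  suitable-D : (3 * a + #max C ≤ 2 + sumF C) ⊎ (a ≡ 1 × 5 ≤ #nonzero C) → Suitable⁺ D
  suitable-D h = suitable h , subst (1 ≤_) (sym maxF-D) a≥1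
    where
      open ≤-Reasoning
      #max-D : #max D + 1 ≡ #max C
      #max-D = trans (cong (_+ 1) (count-cong (λ j → cong (D j ==ℕ_) maxF-D)))
                     (count-decrement-drop C i (_==ℕ a) (trans (cong (_==ℕ a) Ci) ==ℕ-refl)
                        (≢⇒==ℕ-false (subst (λ x → pred x ≢ a) (sym Ci) (<⇒≢ (pred< a≥1)))))
      suitable : (3 * a + #max C ≤ 2 + sumF C) ⊎ (a ≡ 1 × 5 ≤ #nonzero C) → SuitableCounts D
      suitable (inj₁ h) = inj₁ (+-cancelʳ-≤ 1 _ _ (begin
        3 * maxF D + #max D + 1  ≡⟨ cong (λ x → 3 * x + #max D + 1) maxF-D ⟩
        3 * a + #max D + 1       ≡⟨ +-assoc (3 * a) _ 1 ⟩
        3 * a + (#max D + 1)     ≡⟨ cong (3 * a +_) #max-D ⟩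
        3 * a + #max C           ≤⟨ h ⟩
        2 + sumF C               ≡⟨ cong (2 +_) (sumF-decrement C i (subst (1 ≤_) (sym Ci) a≥1)) ⟨
        2 + suc (sumF D)         ≡⟨ cong (2 +_) (+-comm (sumF D) 1) ⟨
        2 + sumF D + 1           ∎))
      suitable (inj₂ (a≡1 , t≥5)) = inj₂ (trans maxF-D a≡1 , +-cancelʳ-≤ 1 4 _ (begin
        5                        ≤⟨ t≥5 ⟩
        #nonzero C               ≡⟨ count-decrement-drop C i (not ∘ (_==ℕ 0)) (cong (not ∘ (_==ℕ 0)) Ci≡1) (cong (not ∘ (_==ℕ 0) ∘ pred) Ci≡1) ⟨
        #nonzero D + 1           ∎))
        where Ci≡1 = trans Ci a≡1

plan-shared-max : ∀ {ℓ} (C : Fin ℓ → ℕ) → Suitable⁺ C → 2 ≤ #max C → Plan C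
plan-shared-max C (s , a≥1) k≥2 with count-witnesses _ 2 k≥2
... | w , w-inj , at-max = plan s
  where
    i₁ = w zero
    i₂ = w (suc zero)
    i₁≢i₂ : i₁ ≢ i₂
    i₁≢i₂ e = 0≢1+n (w-inj e)
    C₁ : C i₁ ≡ maxF C
    C₁ = ==ℕ⇒≡ (at-max zero)
    C₂ : C i₂ ≡ maxF C
    C₂ = ==ℕ⇒≡ (at-max (suc zero))
    offer : (3 * maxF C + #max C ≤ 2 + sumF C) ⊎ (maxF C ≡ 1 × 5 ≤ #nonzero C) → Plan C
    offer h = offerPair i₁ i₂ i₁≢i₂ (subst (1 ≤_) (sym C₁) a≥1) (subst (1 ≤_) (sym C₂) a≥1)
      (SharedMax.suitable-D C i₁≢i₂ C₁ C₂ a≥1 h) (SharedMax.suitable-D C (i₁≢i₂ ∘ sym) C₂ C₁ a≥1 h)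
    plan : SuitableCounts C → Plan C
    plan (inj₁ h) = offer (inj₁ h)
    plan (inj₂ (a≡1 , t≥4)) with 5 ≤? #nonzero C
    ... | yes t≥5 = offer (inj₂ (a≡1 , t≥5))
    ... | no t≱5  = fourSingletons C≤1 (trans (sumF≡#nonzero C C≤1) (≤-antisym (≤-pred (≰⇒> t≱5)) t≥4))
      where
        C≤1 : ∀ j → C j ≤ 1
        C≤1 j = subst (C j ≤_) a≡1 (maxF-upper C j)

-- The case split of UniqueMax below when m ≥ 2 parts hold the second largest value b.
at-b-cases : ∀ {b m e} → 1 ≤ b → 2 ≤ m → 3 * b + 2 ≤ e → suc b + b * m ≤ e →
  (3 * b + m ≤ e) ⊎ (b ≡ 1 × 4 ≤ m) ⊎ (b ≡ 1 × m ≡ 3 × e ≡ 5)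
at-b-cases {m = 1} _ (s≤s ()) _ _
at-b-cases {m = 2} _ _ h _ = inj₁ h
at-b-cases {1} {3} {e} _ _ h _ with 6 ≤? e
... | yes e≥6 = inj₁ e≥6
... | no e≱6  = inj₂ (inj₂ (refl , refl , ≤-antisym (≤-pred (≰⇒> e≱6)) h))
at-b-cases {1} {suc (suc (suc (suc m)))} _ _ _ _ = inj₂ (inj₁ (refl , s≤s (s≤s (s≤s (s≤s z≤n)))))
at-b-cases {suc (suc b)} {suc (suc (suc m))} _ _ _ l = inj₁ (≤-trans (subst (3 * suc (suc b) + suc (suc (suc m)) ≤_) (expand b m) (m≤m+n _ _)) l)
  where
    expand : ∀ b m → 3 * suc (suc b) + suc (suc (suc m)) + (b * m + b + m) ≡ suc (suc (suc b)) + suc (suc b) * suc (suc (suc m))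
    expand = solve-∀

module UniqueMax {ℓ} (C : Fin ℓ → ℕ) (i : Fin ℓ) (b : ℕ) (Ci : C i ≡ suc b)
                 (others : ∀ {j} → j ≢ i → C j ≤ b) (3b+2≤e : 3 * b + 2 ≤ sumF C) where

  private
    C₀ = updateAt C i (const 0)
    C₁ = decrement C i
    D  = decrement C₁
    m  = count (λ x → C x ==ℕ b)
    #b : (Fin ℓ → ℕ) → ℕ
    #b E = count (λ x → E x ==ℕ b)
    open ≤-Reasoning

    C₀-other : ∀ {x} → x ≢ i → C₀ x ≡ C x
    C₀-other {x} = updateAt-minimal x i C

    C₀≤b : ∀ x → C₀ x ≤ b
    C₀≤b x with x ≟ i
    ... | yes refl = ≤-trans (≤-reflexive (updateAt-updates i C)) z≤n
    ... | no x≢i   = ≤-trans (≤-reflexive (C₀-other x≢i)) (others x≢i)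

    value-b⇒≢i : ∀ {x} → C x ≡ b → x ≢ i
    value-b⇒≢i Cx refl = 1+n≢n (trans (sym Ci) Cx)

    lower : suc b + b * m ≤ sumF C
    lower = begin
      suc b + b * m    ≤⟨ +-monoʳ-≤ (suc b) (*-monoʳ-≤ b (count-mono b-in-C₀)) ⟩
      suc b + b * #b C₀ ≤⟨ +-monoʳ-≤ (suc b) (*#value≤sumF C₀ b) ⟩
      suc b + sumF C₀  ≡⟨ cong (_+ sumF C₀) Ci ⟨
      C i + sumF C₀    ≡⟨ sumF-split C i ⟨
      sumF C           ∎
      where
        b-in-C₀ : ∀ x → (C x ==ℕ b) ≡ true → (C₀ x ==ℕ b) ≡ true
        b-in-C₀ x e = trans (cong (_==ℕ b) (C₀-other (value-b⇒≢i (==ℕ⇒≡ e)))) e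

    upper : sumF C ≤ suc b + b * #nonzero C₀
    upper = begin
      sumF C             ≡⟨ sumF-split C i ⟩
      C i + sumF C₀      ≡⟨ cong (_+ sumF C₀) Ci ⟩
      suc b + sumF C₀    ≤⟨ +-monoʳ-≤ (suc b) (sumF≤*#nonzero C₀ C₀≤b) ⟩
      suc b + b * #nonzero C₀ ∎

    b≥1 : 1 ≤ b
    b≥1 = n≢0⇒n>0 λ b≡0 →
      subst (λ x → 3 * x + 2 ≰ suc x + x * #nonzero C₀) (sym b≡0) (λ { (s≤s ()) }) (≤-trans 3b+2≤e upper)

    C₁-at : C₁ i ≡ b
    C₁-at = trans (decrement-at C i) (cong pred Ci)

    C₁≤b : ∀ x → C₁ x ≤ b
    C₁≤b x with x ≟ i
    ... | yes refl = ≤-reflexive C₁-at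
    ... | no x≢i   = ≤-trans (≤-reflexive (decrement-other C i x≢i)) (others x≢i)

    #b-C₁ : #b C₁ ≡ suc m
    #b-C₁ = count-decrement-gain C i (_==ℕ b) (trans (cong (_==ℕ b) Ci) (≢⇒==ℕ-false 1+n≢n))
                                              (trans (cong (λ x → pred x ==ℕ b) Ci) ==ℕ-refl)

    module _ {j : Fin ℓ} (j≢i : j ≢ i) where

      maxF-D : maxF (D j) ≡ b
      maxF-D = maxF-unique (D j) (λ x → ≤-trans (decrement-≤ C₁ j x) (C₁≤b x)) (trans (decrement-other C₁ j (j≢i ∘ sym)) C₁-at)

      sumF-D : 1 ≤ C j → 2 + sumF (D j) ≡ sumF C
      sumF-D Cj≥1 = trans (cong suc (sumF-decrement C₁ j (subst (1 ≤_) (sym (decrement-other C i j≢i)) Cj≥1)))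
                          (sumF-decrement C i (subst (1 ≤_) (sym Ci) (s≤s z≤n)))

      #b-D : #b (D j) + ⟦ C j ==ℕ b ⟧ ≡ suc m + ⟦ pred (C j) ==ℕ b ⟧
      #b-D with count-decrement C₁ j (_==ℕ b)
      ... | e rewrite decrement-other C i j≢i | #b-C₁ = e

      suitable-D : 1 ≤ C j → (3 * b + #b (D j) ≤ sumF C) ⊎ (b ≡ 1 × 4 ≤ #b (D j)) → Suitable⁺ (D j)
      suitable-D Cj≥1 h = suitable h , subst (1 ≤_) (sym maxF-D) b≥1
        where
          #max-D : #max (D j) ≡ #b (D j)
          #max-D = count-cong (λ x → cong (D j x ==ℕ_) maxF-D)
          suitable : (3 * b + #b (D j) ≤ sumF C) ⊎ (b ≡ 1 × 4 ≤ #b (D j)) → SuitableCounts (D j)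
          suitable (inj₁ h) = inj₁ (begin
            3 * maxF (D j) + #max (D j) ≡⟨ cong₂ (λ a k → 3 * a + k) maxF-D #max-D ⟩
            3 * b + #b (D j)            ≤⟨ h ⟩
            sumF C                      ≡⟨ sumF-D Cj≥1 ⟨
            2 + sumF (D j)              ∎)
          suitable (inj₂ (b≡1 , h)) = inj₂ (trans maxF-D b≡1 , ≤-trans h (count-mono b⇒nonzero))
            where
              b⇒nonzero : ∀ x → (D j x ==ℕ b) ≡ true → not (D j x ==ℕ 0) ≡ true
              b⇒nonzero x e rewrite ==ℕ⇒≡ e | b≡1 = refl

    #b-D-at-b : ∀ {j} (Cj : C j ≡ b) → #b (D j) ≡ m
    #b-D-at-b {j} Cj = +-cancelʳ-≡ 1 _ _ (begin-equality
      #b (D j) + 1                       ≡⟨ cong (λ x → #b (D j) + ⟦ x ⟧) (trans (cong (_==ℕ b) Cj) ==ℕ-refl) ⟨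
      #b (D j) + ⟦ C j ==ℕ b ⟧           ≡⟨ #b-D (value-b⇒≢i Cj) ⟩
      suc m + ⟦ pred (C j) ==ℕ b ⟧       ≡⟨ cong (λ x → suc m + ⟦ x ⟧) pred≠b ⟩
      suc m + 0                          ≡⟨ trans (+-identityʳ (suc m)) (+-comm 1 m) ⟩
      m + 1                              ∎)
      where
        pred≠b : (pred (C j) ==ℕ b) ≡ false
        pred≠b = ≢⇒==ℕ-false (subst (λ x → pred x ≢ b) (sym Cj) (<⇒≢ (pred< b≥1)))

    #b-D-below-b : ∀ {j} → j ≢ i → 1 ≤ C j → #b (D j) ≤ suc m
    #b-D-below-b {j} j≢i Cj≥1 = begin
      #b (D j)                           ≤⟨ m≤m+n _ _ ⟩
      #b (D j) + ⟦ C j ==ℕ b ⟧           ≡⟨ #b-D j≢i ⟩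
      suc m + ⟦ pred (C j) ==ℕ b ⟧       ≡⟨ cong (λ x → suc m + ⟦ x ⟧) pred≠b ⟩
      suc m + 0                          ≡⟨ +-identityʳ (suc m) ⟩
      suc m                              ∎
      where
        pred≠b : (pred (C j) ==ℕ b) ≡ false
        pred≠b = ≢⇒==ℕ-false (<⇒≢ (<-≤-trans (pred< Cj≥1) (others j≢i)))

    plan-at-b : 2 ≤ m → Plan C
    plan-at-b m≥2 with count-witnesses _ 2 m≥2
    ... | w , w-inj , at-b = finish (at-b-cases b≥1 m≥2 3b+2≤e lower)
      where
        j₁ = w zero
        j₂ = w (suc zero)
        Cj₁ : C j₁ ≡ b
        Cj₁ = ==ℕ⇒≡ (at-b zero)
        Cj₂ : C j₂ ≡ b
        Cj₂ = ==ℕ⇒≡ (at-b (suc zero))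
        suitable-at-b : ∀ {j} → C j ≡ b → (3 * b + m ≤ sumF C) ⊎ (b ≡ 1 × 4 ≤ m) → Suitable⁺ (D j)
        suitable-at-b Cj h = suitable-D (value-b⇒≢i Cj) (subst (1 ≤_) (sym Cj) b≥1)
          (subst (λ k → (3 * b + k ≤ sumF C) ⊎ (b ≡ 1 × 4 ≤ k)) (sym (#b-D-at-b Cj)) h)
        offer : (3 * b + m ≤ sumF C) ⊎ (b ≡ 1 × 4 ≤ m) → Plan C
        offer h = forceThenOfferPair i j₁ j₂ (value-b⇒≢i Cj₁ ∘ sym) (value-b⇒≢i Cj₂ ∘ sym) (λ e → 0≢1+n (w-inj e))
          (subst (1 ≤_) (sym Ci) (s≤s z≤n)) (subst (1 ≤_) (sym Cj₁) b≥1) (subst (1 ≤_) (sym Cj₂) b≥1)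
          (suitable-at-b Cj₁ h) (suitable-at-b Cj₂ h)
        finish : (3 * b + m ≤ sumF C) ⊎ (b ≡ 1 × 4 ≤ m) ⊎ (b ≡ 1 × m ≡ 3 × sumF C ≡ 5) → Plan C
        finish (inj₁ h)                    = offer (inj₁ h)
        finish (inj₂ (inj₁ h))             = offer (inj₂ h)
        finish (inj₂ (inj₂ (b≡1 , _ , e≡5))) = pairAndThreeSingletons i (trans Ci (cong suc b≡1))
          (λ j j≢i → subst (C j ≤_) b≡1 (others j≢i)) e≡5

    #nonzero-C₀≥2 : 2 ≤ #nonzero C₀
    #nonzero-C₀≥2 with 2 ≤? #nonzero C₀
    ... | yes t≥2 = t≥2
    ... | no t≱2  = contradiction (begin
        3 * b + 2                ≤⟨ 3b+2≤e ⟩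
        sumF C                   ≤⟨ upper ⟩
        suc b + b * #nonzero C₀  ≤⟨ +-monoʳ-≤ (suc b) (*-monoʳ-≤ b (≤-pred (≰⇒> t≱2))) ⟩
        suc b + b * 1            ∎) (<⇒≱ (subst (suc b + b * 1 <_) (expand b) (m≤m+n _ b)))
      where
        expand : ∀ b → suc (suc b + b * 1) + b ≡ 3 * b + 2
        expand = solve-∀

    nonzero-C₀ : ∀ {x} → not (C₀ x ==ℕ 0) ≡ true → x ≢ i × 1 ≤ C x
    nonzero-C₀ {x} nz with x ≟ i
    ... | yes refl = contradiction (trans (sym nz) (cong (not ∘ (_==ℕ 0)) (updateAt-updates i C))) λ ()
    ... | no x≢i   = x≢i , n≢0⇒n>0 λ Cx≡0 →
      contradiction (trans (sym nz) (cong (not ∘ (_==ℕ 0)) (trans (C₀-other x≢i) Cx≡0))) λ ()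

    plan-below-b : m ≤ 1 → Plan C
    plan-below-b m≤1 with count-witnesses _ 2 #nonzero-C₀≥2
    ... | w , w-inj , nonzero = forceThenOfferPair i (w zero) (w (suc zero)) (≢i zero ∘ sym) (≢i (suc zero) ∘ sym)
          (λ e → 0≢1+n (w-inj e)) (subst (1 ≤_) (sym Ci) (s≤s z≤n)) (pos zero) (pos (suc zero))
          (suitable zero) (suitable (suc zero))
      where
        ≢i : ∀ x → w x ≢ i
        ≢i x = proj₁ (nonzero-C₀ (nonzero x))
        pos : ∀ x → 1 ≤ C (w x)
        pos x = proj₂ (nonzero-C₀ (nonzero x))
        suitable : ∀ x → Suitable⁺ (D (w x))
        suitable x = suitable-D (≢i x) (pos x) (inj₁ (begin
          3 * b + #b (D (w x))  ≤⟨ +-monoʳ-≤ (3 * b) (≤-trans (#b-D-below-b (≢i x) (pos x)) (s≤s m≤1)) ⟩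
          3 * b + 2             ≤⟨ 3b+2≤e ⟩
          sumF C                ∎))

  plan : Plan C
  plan with 2 ≤? m
  ... | yes m≥2 = plan-at-b m≥2
  ... | no m≱2  = plan-below-b (≤-pred (≰⇒> m≱2))

plan-unique-max : ∀ {ℓ} (C : Fin ℓ → ℕ) → Suitable⁺ C → #max C ≤ 1 → Plan C
plan-unique-max C (s , a≥1) k≤1 with maxF-attained C a≥1
... | i , Ci = from-suitable s
  where
    a = maxF C
    b = pred a
    a≡1+b : a ≡ suc b
    a≡1+b = suc-pred-of a≥1
      where
        suc-pred-of : ∀ {x} → 1 ≤ x → x ≡ suc (pred x)
        suc-pred-of {suc x} _ = refl
    at-max : ∀ {j} → C j ≡ a → (C j ==ℕ a) ≡ true
    at-max Cj = trans (cong (_==ℕ a) Cj) ==ℕ-refl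
    others : ∀ {j} → j ≢ i → C j ≤ b
    others {j} j≢i = ≤-pred (subst (C j <_) a≡1+b
      (≤∧≢⇒< (maxF-upper C j) (λ Cj → j≢i (count-unique _ k≤1 (at-max Cj) (at-max Ci)))))
    from-suitable : SuitableCounts C → Plan C
    from-suitable (inj₁ h) = UniqueMax.plan C i b (trans Ci a≡1+b) others (+-cancelˡ-≤ 2 _ _ (begin
      2 + (3 * b + 2)          ≡⟨ expand b ⟩
      3 * suc b + 1            ≡⟨ cong₂ (λ x k → 3 * x + k) a≡1+b k≡1 ⟨
      3 * a + #max C           ≤⟨ h ⟩
      2 + sumF C               ∎))
      where
        open ≤-Reasoning
        k≡1 : #max C ≡ 1
        k≡1 = ≤-antisym k≤1 (count-pos (λ j → C j ==ℕ a) (at-max Ci))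
        expand : ∀ b → 2 + (3 * b + 2) ≡ 3 * suc b + 1
        expand = solve-∀
    from-suitable (inj₂ (a≡1 , t≥4)) = contradiction (≤-trans t≥4 (≤-trans (count-mono nonzero⇒max) k≤1)) λ { (s≤s ()) }
      where
        nonzero⇒max : ∀ j → not (C j ==ℕ 0) ≡ true → (C j ==ℕ a) ≡ true
        nonzero⇒max j nz with C j | maxF-upper C j
        ... | suc zero | _ = trans (cong (1 ==ℕ_) a≡1) (==ℕ-refl {1})
        ... | suc (suc _) | Cj≤a = contradiction (subst (_ ≤_) a≡1 Cj≤a) λ { (s≤s ()) }

plan : ∀ {ℓ} (C : Fin ℓ → ℕ) → Suitable⁺ C → Plan C
plan C s with 2 ≤? #max C
... | yes k≥2 = plan-shared-max C s k≥2
... | no k≱2  = plan-unique-max C s (≤-pred (≰⇒> k≱2))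

nonzero⇒pos : ∀ {x} → not (x ==ℕ 0) ≡ true → 1 ≤ x
nonzero⇒pos {suc x} _ = s≤s z≤n

pos⇒nonzero : ∀ {x} → 1 ≤ x → not (x ==ℕ 0) ≡ true
pos⇒nonzero {suc x} _ = refl

other-nonzero : ∀ {ℓ} (C : Fin ℓ → ℕ) {i₀} k → (∀ j → C j ≤ 1) → 1 ≤ C i₀ → suc k ≤ sumF C →
  Σ (Fin k → Fin ℓ) λ w → (∀ {x y} → w x ≡ w y → x ≡ y) × (∀ x → w x ≢ i₀ × 1 ≤ C (w x))
other-nonzero {ℓ} C {i₀} k C≤1 Ci₀ e>k with count-witnesses (remove nonzero i₀) k others
  where
    nonzero : Fin ℓ → Bool
    nonzero j = not (C j ==ℕ 0)
    others : k ≤ count (remove nonzero i₀)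
    others = ≤-pred (begin
      suc k                           ≤⟨ e>k ⟩
      sumF C                          ≡⟨ sumF≡#nonzero C C≤1 ⟩
      count nonzero                   ≡⟨ count-remove nonzero i₀ (pos⇒nonzero Ci₀) ⟨
      suc (count (remove nonzero i₀)) ∎)
      where open ≤-Reasoning
... | w , w-inj , in-w = w , w-inj , λ x → let (nz , w≢i₀) = remove-sound _ i₀ (in-w x) in w≢i₀ , nonzero⇒pos nz

#nonzero≤sumF : ∀ {ℓ} (C : Fin ℓ → ℕ) → #nonzero C ≤ sumF C
#nonzero≤sumF C = ≤-trans (≤-reflexive (count≡sumF (λ j → not (C j ==ℕ 0)))) (sumF-mono indicator≤)
  where
    indicator≤ : ∀ j → ⟦ not (C j ==ℕ 0) ⟧ ≤ C j
    indicator≤ j with C j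
    ... | zero  = z≤n
    ... | suc _ = s≤s z≤n

Suitable⁺⇒sumF≥2 : ∀ {ℓ} (C : Fin ℓ → ℕ) → Suitable⁺ C → 2 ≤ sumF C
Suitable⁺⇒sumF≥2 C (inj₁ h , a≥1) with maxF-attained C a≥1
... | i , Ci = +-cancelˡ-≤ 2 _ _ (begin
  4                   ≤⟨ +-mono-≤ (*-monoʳ-≤ 3 a≥1) (count-pos (λ j → C j ==ℕ maxF C) (trans (cong (_==ℕ maxF C) Ci) ==ℕ-refl)) ⟩
  3 * maxF C + #max C ≤⟨ h ⟩
  2 + sumF C          ∎)
  where open ≤-Reasoning
Suitable⁺⇒sumF≥2 C (inj₂ (_ , t≥4) , _) = ≤-trans (s≤s (s≤s z≤n)) (≤-trans t≥4 (#nonzero≤sumF C))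

module _ {n : ℕ} (i j : Fin n) where

  transpose-at-i : transpose i j i ≡ j
  transpose-at-i rewrite dec-true (i ≟ i) refl = refl

  transpose-at-j : transpose i j j ≡ i
  transpose-at-j with j ≟ i
  ... | yes j≡i = j≡i
  ... | no _ rewrite dec-true (j ≟ j) refl = refl

  transpose-other : ∀ {k} → k ≢ i → k ≢ j → transpose i j k ≡ k
  transpose-other {k} k≢i k≢j rewrite dec-false (k ≟ i) k≢i | dec-false (k ≟ j) k≢j = refl

  data TransposeView (k : Fin n) : Set where
    at-i  : k ≡ i → transpose i j k ≡ j → TransposeView k
    at-j  : k ≡ j → transpose i j k ≡ i → TransposeView k
    other : k ≢ i → k ≢ j → transpose i j k ≡ k → TransposeView k

  transpose-view : ∀ k → TransposeView k
  transpose-view k with k ≟ i | k ≟ j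
  ... | yes refl | _        = at-i refl transpose-at-i
  ... | no _     | yes refl = at-j refl transpose-at-j
  ... | no k≢i   | no k≢j   = other k≢i k≢j (transpose-other k≢i k≢j)

  transpose-preserves : (P : Fin n → Set) → P i → P j → ∀ {k} → P k → P (transpose i j k)
  transpose-preserves P Pi Pj {k} Pk with transpose-view k
  ... | at-i _ e    = subst P (sym e) Pj
  ... | at-j _ e    = subst P (sym e) Pi
  ... | other _ _ e = subst P (sym e) Pk

  transpose-involutive : ∀ k → transpose i j (transpose i j k) ≡ k
  transpose-involutive k with transpose-view k
  ... | at-i refl e      = trans (cong (transpose i j) e) transpose-at-j
  ... | at-j refl e      = trans (cong (transpose i j) e) transpose-at-i
  ... | other _ _ e      = trans (cong (transpose i j) e) e

  transpose-fixed⁻¹ : ∀ {k l} → l ≢ i → l ≢ j → transpose i j k ≡ l → k ≡ l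
  transpose-fixed⁻¹ {k} {l} l≢i l≢j e =
    trans (sym (transpose-involutive k)) (trans (cong (transpose i j) e) (transpose-other l≢i l≢j))

  transpose-to-i : ∀ {k} → transpose i j k ≡ i → k ≡ j
  transpose-to-i {k} e = trans (sym (transpose-involutive k)) (trans (cong (transpose i j) e) transpose-at-i)

  transpose-injective : ∀ {k l} → transpose i j k ≡ transpose i j l → k ≡ l
  transpose-injective {k} {l} e =
    trans (sym (transpose-involutive k)) (trans (cong (transpose i j) e) (transpose-involutive l))

free? : (k : Colour) → Dec (k ≡ free)
free? free = yes refl
free? red  = no λ ()
free? blue = no λ ()

module _ {n : ℕ} (k : Colour) (u v : Fin n) (c : Colouring n) where

  paint-on : ∀ {x y} → SameEdge x y u v → paint k u v c x y ≡ k
  paint-on (inj₁ (refl , refl)) rewrite ==-refl {i = u} | ==-refl {i = v} = refl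
  paint-on (inj₂ (refl , refl)) rewrite ==-refl {i = u} | ==-refl {i = v}
                                      | ∨-comm ((v == u) ∧ (u == v)) true = refl

  paint-off : ∀ {x y} → ¬ SameEdge x y u v → paint k u v c x y ≡ c x y
  paint-off {x} {y} ¬same with x == u in xu | y == v in yv | x == v in xv | y == u in yu
  ... | true  | true  | _     | _     = contradiction (inj₁ (==⇒≡ xu , ==⇒≡ yv)) ¬same
  ... | _     | _     | true  | true  = contradiction (inj₂ (==⇒≡ xv , ==⇒≡ yu)) ¬same
  ... | false | _     | false | _     = refl
  ... | false | _     | true  | false = refl
  ... | true  | false | false | _     = refl
  ... | true  | false | true  | false = refl

  paint-untouched : ∀ {x y} → x ≢ u → x ≢ v → paint k u v c x y ≡ c x y
  paint-untouched x≢u x≢v = paint-off λ { (inj₁ (x≡u , _)) → x≢u x≡u ; (inj₂ (x≡v , _)) → x≢v x≡v }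

  paint-untouched′ : ∀ {x y} → y ≢ u → y ≢ v → paint k u v c x y ≡ c x y
  paint-untouched′ y≢u y≢v = paint-off λ { (inj₁ (_ , y≡v)) → y≢v y≡v ; (inj₂ (_ , y≡u)) → y≢u y≡u }

  paint-loopless : u ≢ v → ∀ x → paint k u v c x x ≡ c x x
  paint-loopless u≢v x = paint-off λ { (inj₁ (refl , refl)) → u≢v refl ; (inj₂ (refl , refl)) → u≢v refl }

  paint-sym : (∀ x y → c x y ≡ c y x) → ∀ x y → paint k u v c x y ≡ paint k u v c y x
  paint-sym c-sym x y
    rewrite ∧-comm (x == u) (y == v) | ∧-comm (x == v) (y == u)
          | ∨-comm ((y == v) ∧ (x == u)) ((y == u) ∧ (x == v)) | c-sym x y = refl

module _ {n : ℕ} {R : Fin n → Set} (R? : Decidable R) (ρ : Fin n → Fin n)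
         (ρ-injective : ∀ {r r′} → R r → R r′ → ρ r ≡ ρ r′ → r ≡ r′) where

  private
    place : List (Fin n) → (Fin n → Fin n) → (Fin n → Fin n)
    place []       h = h
    place (v ∷ vs) h with R? v
    ... | yes _ = place vs (transpose (h v) (ρ v) ∘ h)
    ... | no _  = place vs h

    place-correct : ∀ vs h → (∀ {x y} → h x ≡ h y → x ≡ y) → (∀ r → R r → r ∉ vs → h r ≡ ρ r) →
      (∀ {x y} → place vs h x ≡ place vs h y → x ≡ y) × (∀ r → R r → place vs h r ≡ ρ r)
    place-correct []       h h-inj h-ρ = h-inj , λ r Rr → h-ρ r Rr λ ()
    place-correct (v ∷ vs) h h-inj h-ρ with R? v
    ... | no ¬Rv = place-correct vs h h-inj λ r Rr r∉vs → h-ρ r Rr λ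
      { (here refl) → ¬Rv Rr ; (there r∈vs) → r∉vs r∈vs }
    ... | yes Rv = place-correct vs h′ (h-inj ∘ transpose-injective (h v) (ρ v)) h′-ρ
      where
        h′ = transpose (h v) (ρ v) ∘ h
        h′-ρ : ∀ r → R r → r ∉ vs → h′ r ≡ ρ r
        h′-ρ r Rr r∉vs with r ≟ v
        ... | yes refl = transpose-at-i (h r) (ρ r)
        ... | no r≢v   = trans (cong (transpose (h v) (ρ v)) hr) (transpose-other (h v) (ρ v)
                           (λ ρr≡hv → r≢v (h-inj (trans hr ρr≡hv))) (λ ρr≡ρv → r≢v (ρ-injective Rr Rv ρr≡ρv)))
          where
            hr : h r ≡ ρ r
            hr = h-ρ r Rr λ { (here r≡v) → r≢v r≡v ; (there r∈vs) → r∉vs r∈vs }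

  extend-injection : Σ (Fin n → Fin n) λ φ → (∀ {x y} → φ x ≡ φ y → x ≡ y) × (∀ r → R r → φ r ≡ ρ r)
  extend-injection = place (allFin n) id , place-correct (allFin n) id id (λ r _ r∉ → contradiction (∈-allFin r) r∉)

IsEdge-sym : ∀ {n ℓ} (F : ForestTuple n ℓ) {x y} → IsEdge F x y → IsEdge F y x
IsEdge-sym F (inj₁ e) = inj₂ e
IsEdge-sym F (inj₂ e) = inj₁ e

SameEdge-flip : ∀ {n} {x y u v : Fin n} → SameEdge x y u v → SameEdge x y v u
SameEdge-flip (inj₁ (x≡u , y≡v)) = inj₂ (x≡u , y≡v)
SameEdge-flip (inj₂ (x≡v , y≡u)) = inj₁ (x≡v , y≡u)

sameEdge? : ∀ {n} (x y u v : Fin n) → Dec (SameEdge x y u v)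
sameEdge? x y u v = ((x ≟ u) ×-dec (y ≟ v)) ⊎-dec ((x ≟ v) ×-dec (y ≟ u))

module Game {n ℓ : ℕ} (F : ForestTuple n ℓ) (ρ : Fin n → Fin n) where

  Allowed : Set₁
  Allowed = Fin n → Fin n → Set

  _⟨_↔_⟩ : Allowed → Fin n → Fin n → Allowed
  (A ⟨ v ↔ w ⟩) z y = A (transpose v w z) (transpose v w y)

  Admissible : Fin n → Colour → Fin n → Set
  Admissible x k y = part F x ≡ part F y → (k ≢ blue) × (k ≡ red → IsEdge F x y)

  Admissible-free : ∀ {x y} → Admissible x free y
  Admissible-free _ = (λ ()) , (λ ())

  Admissible-apart : ∀ {x k y} → part F x ≢ part F y → Admissible x k y
  Admissible-apart apart same = contradiction same apart

  Admissible-tree : ∀ {v p} → parent F v ≡ just p → Admissible v red p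
  Admissible-tree pv _ = (λ ()) , λ _ → inj₁ pv

  Admissible-sym : ∀ {x k y} → Admissible x k y → Admissible y k x
  Admissible-sym adm same = proj₁ (adm (sym same)) , IsEdge-sym F ∘ proj₂ (adm (sym same))

  -- φ places every vertex of F on the board, U marks the vertices not yet
  -- embedded (their places may still be exchanged), and A bounds the
  -- coloured edges at their places.
  record Invariant (c : Colouring n) (φ : Fin n → Fin n) (U : Fin n → Bool) (A : Allowed) : Set where
    field
      symmetric       : ∀ x y → c x y ≡ c y x
      loopless        : ∀ x → c x x ≡ free
      injective       : ∀ {x y} → φ x ≡ φ y → x ≡ y
      roots-placed    : ∀ r → IsRoot F r → φ r ≡ ρ r
      roots-embedded  : ∀ r → IsRoot F r → U r ≡ false
      embedded-closed : ∀ {x y} → U x ≡ false → parent F x ≡ just y → U y ≡ false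
      admissible      : ∀ x y → Admissible x (c (φ x) (φ y)) y
      tree-red        : ∀ {x y} → U x ≡ false → parent F x ≡ just y → c (φ x) (φ y) ≡ red
      roots-free      : ∀ {r r′} → IsRoot F r → IsRoot F r′ → r ≢ r′ → c (φ r) (φ r′) ≡ free
      pending-allowed : ∀ {z} y → U z ≡ true → c (φ z) (φ y) ≢ free → A z y

  pending≢embedded : ∀ {U : Fin n → Bool} {x y} → U x ≡ true → U y ≡ false → x ≢ y
  pending≢embedded Ux Uy refl = true≢false (trans (sym Ux) Uy)

  module _ {c φ U A} (I : Invariant c φ U A) where
    open Invariant I

    weaken : ∀ {B : Allowed} → (∀ {z y} → U z ≡ true → A z y → B z y) → Invariant c φ U B
    weaken A⇒B = record
      { symmetric = symmetric ; loopless = loopless ; injective = injective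
      ; roots-placed = roots-placed ; roots-embedded = roots-embedded ; embedded-closed = embedded-closed
      ; admissible = admissible ; tree-red = tree-red ; roots-free = roots-free
      ; pending-allowed = λ y Uz c≢free → A⇒B Uz (pending-allowed y Uz c≢free) }

    free-unless-allowed : ∀ {z y} → U z ≡ true → ¬ A z y → c (φ z) (φ y) ≡ free
    free-unless-allowed {z} {y} Uz ¬A with free? (c (φ z) (φ y))
    ... | yes isFree = isFree
    ... | no ¬free   = contradiction (pending-allowed y Uz ¬free) ¬A

    free-unless-allowed′ : ∀ {z y} → U z ≡ true → ¬ A z y → c (φ y) (φ z) ≡ free
    free-unless-allowed′ Uz ¬A = trans (symmetric _ _) (free-unless-allowed Uz ¬A)

    ≢-placed : ∀ {x y} → x ≢ y → φ x ≢ φ y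
    ≢-placed x≢y = x≢y ∘ injective

    placed-view : ∀ {k a b} x y →
      let c′ = paint k (φ b) (φ a) c in
      (c′ (φ x) (φ y) ≡ c (φ x) (φ y)) ⊎ (c′ (φ x) (φ y) ≡ k × SameEdge x y a b)
    placed-view {k} {a} {b} x y with sameEdge? (φ x) (φ y) (φ b) (φ a)
    ... | no ¬same = inj₁ (paint-off k (φ b) (φ a) c ¬same)
    ... | yes same = inj₂ (paint-on k (φ b) (φ a) c same , SameEdge-flip (unplace same))
      where
        unplace : SameEdge (φ x) (φ y) (φ b) (φ a) → SameEdge x y b a
        unplace (inj₁ (e₁ , e₂)) = inj₁ (injective e₁ , injective e₂)
        unplace (inj₂ (e₁ , e₂)) = inj₂ (injective e₁ , injective e₂)

    paint-invariant : (k : Colour) {a b : Fin n} → U a ≡ true → a ≢ b → Admissible a k b →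
      Invariant (paint k (φ b) (φ a) c) φ U (A ∪ λ z y → SameEdge z y a b)
    paint-invariant k {a} {b} Ua a≢b adm = record
      { symmetric = paint-sym k (φ b) (φ a) c symmetric
      ; loopless = λ x → trans (paint-loopless k (φ b) (φ a) c (≢-placed (a≢b ∘ sym)) x) (loopless x)
      ; injective = injective ; roots-placed = roots-placed ; roots-embedded = roots-embedded
      ; embedded-closed = embedded-closed
      ; admissible = admissible′ ; tree-red = tree-red′ ; roots-free = roots-free′
      ; pending-allowed = pending-allowed′ }
      where
        c′ = paint k (φ b) (φ a) c
        admissible′ : ∀ x y → Admissible x (c′ (φ x) (φ y)) y
        admissible′ x y with placed-view {k} {a} {b} x y
        ... | inj₁ e = subst (λ k′ → Admissible x k′ y) (sym e) (admissible x y)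
        ... | inj₂ (e , inj₁ (refl , refl)) = subst (λ k′ → Admissible x k′ y) (sym e) adm
        ... | inj₂ (e , inj₂ (refl , refl)) = subst (λ k′ → Admissible x k′ y) (sym e) (Admissible-sym adm)
        tree-red′ : ∀ {x y} → U x ≡ false → parent F x ≡ just y → c′ (φ x) (φ y) ≡ red
        tree-red′ {x} {y} Ux px with placed-view {k} {a} {b} x y
        ... | inj₁ e = trans e (tree-red Ux px)
        ... | inj₂ (_ , inj₁ (refl , refl)) = contradiction refl (pending≢embedded {U} Ua Ux)
        ... | inj₂ (_ , inj₂ (refl , refl)) = contradiction refl (pending≢embedded {U} Ua (embedded-closed Ux px))
        roots-free′ : ∀ {r r′} → IsRoot F r → IsRoot F r′ → r ≢ r′ → c′ (φ r) (φ r′) ≡ free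
        roots-free′ {r} {r′} root root′ r≢r′ with placed-view {k} {a} {b} r r′
        ... | inj₁ e = trans e (roots-free root root′ r≢r′)
        ... | inj₂ (_ , inj₁ (refl , refl)) = contradiction refl (pending≢embedded {U} Ua (roots-embedded r root))
        ... | inj₂ (_ , inj₂ (refl , refl)) = contradiction refl (pending≢embedded {U} Ua (roots-embedded r′ root′))
        pending-allowed′ : ∀ {z} y → U z ≡ true → c′ (φ z) (φ y) ≢ free → (A ∪ λ z y → SameEdge z y a b) z y
        pending-allowed′ {z} y Uz c′≢free with placed-view {k} {a} {b} z y
        ... | inj₁ e    = inj₁ (pending-allowed y Uz (c′≢free ∘ trans e))
        ... | inj₂ (_ , same) = inj₂ same

    admissible-transposed : ∀ {v w} → c (φ v) (φ w) ≡ free →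
      (∀ y → y ≢ v → y ≢ w → Admissible v (c (φ w) (φ y)) y) →
      (∀ y → y ≢ v → y ≢ w → Admissible w (c (φ v) (φ y)) y) →
      ∀ x y → Admissible x (c (φ (transpose v w x)) (φ (transpose v w y))) y
    admissible-transposed {v} {w} vw-free adm-v adm-w x y = go (transpose-view v w x) (transpose-view v w y)
      where
        τ = transpose v w
        at : ∀ {x′ y′} → τ x ≡ x′ → τ y ≡ y′ → Admissible x (c (φ x′) (φ y′)) y → Admissible x (c (φ (τ x)) (φ (τ y))) y
        at refl refl adm = adm
        free-at : ∀ {x′ y′} → τ x ≡ x′ → τ y ≡ y′ → c (φ x′) (φ y′) ≡ free → Admissible x (c (φ (τ x)) (φ (τ y))) y
        free-at ex ey e = at ex ey (subst (λ k → Admissible x k y) (sym e) Admissible-free)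
        flipped : ∀ {x′ y′} → τ x ≡ x′ → τ y ≡ y′ → Admissible y (c (φ y′) (φ x′)) x → Admissible x (c (φ (τ x)) (φ (τ y))) y
        flipped ex ey adm = at ex ey (subst (λ k → Admissible x k y) (symmetric _ _) (Admissible-sym adm))
        go : TransposeView v w x → TransposeView v w y → Admissible x (c (φ (τ x)) (φ (τ y))) y
        go (at-i refl ex)     (at-i refl ey)     = free-at ex ey (loopless _)
        go (at-i refl ex)     (at-j refl ey)     = free-at ex ey (trans (symmetric _ _) vw-free)
        go (at-i refl ex)     (other y≢v y≢w ey) = at ex ey (adm-v y y≢v y≢w)
        go (at-j refl ex)     (at-i refl ey)     = free-at ex ey vw-free
        go (at-j refl ex)     (at-j refl ey)     = free-at ex ey (loopless _)
        go (at-j refl ex)     (other y≢v y≢w ey) = at ex ey (adm-w y y≢v y≢w)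
        go (other x≢v x≢w ex) (at-i refl ey)     = flipped ex ey (adm-v x x≢v x≢w)
        go (other x≢v x≢w ex) (at-j refl ey)     = flipped ex ey (adm-w x x≢v x≢w)
        go (other _ _ ex)     (other _ _ ey)     = at ex ey (admissible x y)

    relabel : ∀ {v w} → v ≢ w → U v ≡ true → U w ≡ true → c (φ v) (φ w) ≡ free →
      (∀ y → y ≢ v → y ≢ w → Admissible v (c (φ w) (φ y)) y) →
      (∀ y → y ≢ v → y ≢ w → Admissible w (c (φ v) (φ y)) y) →
      Invariant c (φ ∘ transpose v w) U (A ⟨ v ↔ w ⟩)
    relabel {v} {w} v≢w Uv Uw vw-free adm-v adm-w = record
      { symmetric = symmetric ; loopless = loopless
      ; injective = transpose-injective v w ∘ injective
      ; roots-placed = λ r root → trans (cong φ (fixed (roots-embedded r root))) (roots-placed r root)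
      ; roots-embedded = roots-embedded ; embedded-closed = embedded-closed
      ; admissible = admissible-transposed vw-free adm-v adm-w
      ; tree-red = λ Ux px → subst₂ (λ x y → c (φ x) (φ y) ≡ red)
                                   (sym (fixed Ux)) (sym (fixed (embedded-closed Ux px))) (tree-red Ux px)
      ; roots-free = λ {r} {r′} root root′ r≢r′ → subst₂ (λ x y → c (φ x) (φ y) ≡ free)
          (sym (fixed (roots-embedded r root))) (sym (fixed (roots-embedded r′ root′))) (roots-free root root′ r≢r′)
      ; pending-allowed = λ y Uz → pending-allowed (transpose v w y) (transpose-preserves v w (λ x → U x ≡ true) Uv Uw Uz) }
      where
        fixed : ∀ {x} → U x ≡ false → transpose v w x ≡ x
        fixed Ux = transpose-other v w (pending≢embedded {U} Uv Ux ∘ sym) (pending≢embedded {U} Uw Ux ∘ sym)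

    embed : ∀ {v p} → U v ≡ true → parent F v ≡ just p → U p ≡ false → c (φ v) (φ p) ≡ red →
      Invariant c φ (remove U v) A
    embed {v} {p} Uv pv Up vp-red = record
      { symmetric = symmetric ; loopless = loopless ; injective = injective ; roots-placed = roots-placed
      ; roots-embedded = λ r root → remove-false U v (roots-embedded r root)
      ; embedded-closed = closed
      ; admissible = admissible
      ; tree-red = red′
      ; roots-free = roots-free
      ; pending-allowed = λ y Uz → pending-allowed y (proj₁ (remove-sound U v Uz)) }
      where
        closed : ∀ {x y} → remove U v x ≡ false → parent F x ≡ just y → remove U v y ≡ false
        closed {x} {y} Ux px with remove-false-view U v Ux
        ... | inj₁ refl = remove-false U v (subst (λ z → U z ≡ false) (just-injective (trans (sym pv) px)) Up)
        ... | inj₂ Ux′  = remove-false U v (embedded-closed Ux′ px)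
        red′ : ∀ {x y} → remove U v x ≡ false → parent F x ≡ just y → c (φ x) (φ y) ≡ red
        red′ {x} {y} Ux px with remove-false-view U v Ux
        ... | inj₁ refl rewrite just-injective (trans (sym px) pv) = vp-red
        ... | inj₂ Ux′  = tree-red Ux′ px

  #pending : (Fin n → Bool) → Fin ℓ → ℕ
  #pending U j = count (λ v → (part F v == j) ∧ U v)

  module _ {U : Fin n → Bool} where

    private
      counted : ∀ {x j} → part F x ≡ j → U x ≡ true → ((part F x == j) ∧ U x) ≡ true
      counted {x} refl Ux = cong₂ _∧_ (==-refl {i = part F x}) Ux

    #pending-pos : ∀ {x} → U x ≡ true → 1 ≤ #pending U (part F x)
    #pending-pos {x} Ux = count-pos (λ v → (part F v == part F x) ∧ U v) (counted refl Ux)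

    pending-unique : ∀ {j x y} → #pending U j ≤ 1 → U x ≡ true → U y ≡ true → part F x ≡ j → part F y ≡ j → x ≡ y
    pending-unique {j} h Ux Uy px py = count-unique (λ v → (part F v == j) ∧ U v) h (counted px Ux) (counted py Uy)

    #pending-remove : ∀ {v} → U v ≡ true → ∀ j → #pending (remove U v) j ≡ decrement (#pending U) (part F v) j
    #pending-remove {v} Uv j with j ≟ part F v
    ... | yes refl = begin
      #pending (remove U v) j                                     ≡⟨ cong pred (+-comm 1 _) ⟩
      pred (#pending (remove U v) j + 1)                          ≡⟨ cong (λ b → pred (#pending (remove U v) j + ⟦ b ⟧)) (cong₂ _∧_ (==-refl {i = j}) Uv) ⟨
      pred (#pending (remove U v) j + ⟦ (part F v == j) ∧ U v ⟧)  ≡⟨ cong pred (count-∧-remove _ U v) ⟩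
      pred (#pending U j)                                         ≡⟨ decrement-at (#pending U) j ⟨
      decrement (#pending U) j j                                  ∎
      where open ≡-Reasoning
    ... | no j≢pv = begin
      #pending (remove U v) j                                     ≡⟨ +-identityʳ _ ⟨
      #pending (remove U v) j + 0                                 ≡⟨ cong (λ b → #pending (remove U v) j + ⟦ b ∧ U v ⟧) (≢⇒==-false (j≢pv ∘ sym)) ⟨
      #pending (remove U v) j + ⟦ (part F v == j) ∧ U v ⟧         ≡⟨ count-∧-remove _ U v ⟩
      #pending U j                                                ≡⟨ decrement-other (#pending U) (part F v) j≢pv ⟨
      decrement (#pending U) (part F v) j                         ∎
      where open ≡-Reasoning

    sumF-#pending-remove : ∀ {v} → U v ≡ true → suc (sumF (#pending (remove U v))) ≡ sumF (#pending U)
    sumF-#pending-remove Uv = trans (cong suc (sumF-cong (#pending-remove Uv)))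
                                    (sumF-decrement (#pending U) _ (#pending-pos Uv))

    #pending-remove-≤1 : ∀ {v} → U v ≡ true → (∀ j → #pending U j ≤ 1) → ∀ j → #pending (remove U v) j ≤ 1
    #pending-remove-≤1 {v} Uv ≤1 j =
      ≤-trans (≤-reflexive (#pending-remove Uv j)) (≤-trans (decrement-≤ (#pending U) (part F v) j) (≤1 j))

  record Slot (U : Fin n → Bool) (j : Fin ℓ) : Set where
    field
      v      : Fin n
      p      : Fin n
      Uv     : U v ≡ true
      pv     : parent F v ≡ just p
      Up     : U p ≡ false
      part-v : part F v ≡ j

    part-p : part F p ≡ j
    part-p = trans (sym (samePart F v p pv)) part-v

  slot-above : ∀ {U} → (∀ r → IsRoot F r → U r ≡ false) →
    ∀ z → Acc (ParentRel (parent F)) z → U z ≡ true → Slot U (part F z)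
  slot-above {U} roots z (acc below) Uz with parent F z in pz
  ... | nothing = contradiction refl (pending≢embedded {U} Uz (roots z pz))
  ... | just y with U y in Uy
  ...   | false = record { v = z ; p = y ; Uv = Uz ; pv = pz ; Up = Uy ; part-v = refl }
  ...   | true  = record { Slot s ; part-v = trans (Slot.part-v s) (sym (samePart F z y pz)) }
    where s = slot-above roots y (below refl) Uy

  slot : ∀ {U} → (∀ r → IsRoot F r → U r ≡ false) → ∀ j → 1 ≤ #pending U j → Slot U j
  slot {U} roots j h with count-witness _ h
  ... | z , e with (part F z == j) in pz | U z in Uz
  ... | true | true = subst (Slot U) (==⇒≡ pz) (slot-above roots z (acyclic F z) Uz)

  Forced : ℕ → Colouring n → Set
  Forced = Forces (Goal F ρ)

  infix 7 _⇢_
  _⇢_ : Fin n → Fin n → Allowed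
  (u ⇢ p) z y = z ≡ u × y ≡ p

  -- Exchanging the places of v and w is harmless when no coloured edge at
  -- v or w stays inside the part of v or of w.
  Swappable : Allowed → Fin n → Fin n → Set
  Swappable A v w = ∀ {z y} → (z ≡ v ⊎ z ≡ w) → A z y → part F v ≢ part F y × part F w ≢ part F y

  module _ {c φ U A} (I : Invariant c φ U A) where
    open Invariant I

    relabel-allowed : ∀ {v w} → v ≢ w → U v ≡ true → U w ≡ true → ¬ A v w → Swappable A v w →
      Invariant c (φ ∘ transpose v w) U (A ⟨ v ↔ w ⟩)
    relabel-allowed {v} {w} v≢w Uv Uw ¬Avw safe =
      relabel I v≢w Uv Uw (free-unless-allowed I Uv ¬Avw) adm-v adm-w
      where
        adm-v : ∀ y → y ≢ v → y ≢ w → Admissible v (c (φ w) (φ y)) y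
        adm-v y _ _ with free? (c (φ w) (φ y))
        ... | yes isFree = subst (λ k → Admissible v k y) (sym isFree) Admissible-free
        ... | no ¬free   = Admissible-apart (proj₁ (safe (inj₂ refl) (pending-allowed y Uw ¬free)))
        adm-w : ∀ y → y ≢ v → y ≢ w → Admissible w (c (φ v) (φ y)) y
        adm-w y _ _ with free? (c (φ v) (φ y))
        ... | yes isFree = subst (λ k → Admissible w k y) (sym isFree) Admissible-free
        ... | no ¬free   = Admissible-apart (proj₂ (safe (inj₁ refl) (pending-allowed y Uv ¬free)))

  paint²-cong : ∀ {k₁ k₂} {a₁ b₁ a₂ b₂ a₁′ b₁′ a₂′ b₂′ : Fin n} (c : Colouring n) →
    a₁ ≡ a₁′ → b₁ ≡ b₁′ → a₂ ≡ a₂′ → b₂ ≡ b₂′ → paint k₁ a₁ b₁ (paint k₂ a₂ b₂ c) ≡ paint k₁ a₁′ b₁′ (paint k₂ a₂′ b₂′ c)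
  paint²-cong c refl refl refl refl = refl

  module _ {c φ U A} (I : Invariant c φ U A) where

    paint-towards-embedded : (k : Colour) {a b : Fin n} → U a ≡ true → U b ≡ false → Admissible a k b →
      Invariant (paint k (φ b) (φ a) c) φ U (A ∪ a ⇢ b)
    paint-towards-embedded k {a} {b} Ua Ub adm =
      weaken (paint-invariant I k Ua (pending≢embedded {U} Ua Ub) adm) λ where
        _  (inj₁ α)                  → inj₁ α
        _  (inj₂ (inj₁ edge))        → inj₂ edge
        Uz (inj₂ (inj₂ (z≡b , _)))   → contradiction z≡b (pending≢embedded {U} Uz Ub)

    placed-fixed : ∀ {v w x} → U v ≡ true → U w ≡ true → U x ≡ false → φ (transpose v w x) ≡ φ x
    placed-fixed {v} {w} Uv Uw Ux =
      cong φ (transpose-other v w (pending≢embedded {U} Uv Ux ∘ sym) (pending≢embedded {U} Uw Ux ∘ sym))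

  module _ {c φ U A} (I : Invariant c φ U A) {v p : Fin n} (Uv : U v ≡ true) (pv : parent F v ≡ just p)
           (Up : U p ≡ false) where

    private
      not-v : ∀ {z} → remove U v z ≡ true → z ≢ v
      not-v Uz = proj₂ (remove-sound U v Uz)

    embed-pendant : ∀ {b} → U b ≡ false → part F v ≢ part F b →
      Invariant (paint red (φ p) (φ v) (paint blue (φ b) (φ v) c)) φ (remove U v) A
    embed-pendant {b} Ub v≁b = weaken (embed I₂ Uv pv Up (paint-on red (φ p) (φ v) (paint blue (φ b) (φ v) c) (inj₂ (refl , refl)))) λ where
        _  (inj₁ (inj₁ α))          → α
        Uz (inj₁ (inj₂ (z≡v , _)))  → contradiction z≡v (not-v Uz)
        Uz (inj₂ (z≡v , _))         → contradiction z≡v (not-v Uz)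
      where
        I₁ = paint-towards-embedded I blue Uv Ub (Admissible-apart v≁b)
        I₂ = paint-towards-embedded I₁ red Uv Up (Admissible-tree pv)

    embed-beside : ∀ {u} → U u ≡ true → part F u ≢ part F v →
      Invariant (paint red (φ p) (φ v) (paint blue (φ p) (φ u) c)) φ (remove U v) (A ∪ u ⇢ p)
    embed-beside {u} Uu u≁v = weaken (embed I₂ Uv pv Up (paint-on red (φ p) (φ v) (paint blue (φ p) (φ u) c) (inj₂ (refl , refl)))) λ where
        _  (inj₁ α)              → α
        Uz (inj₂ (z≡v , _))      → contradiction z≡v (not-v Uz)
      where
        I₁ = paint-towards-embedded I blue Uu Up (Admissible-apart λ u∼p → u≁v (trans u∼p (sym (samePart F v p pv))))
        I₂ = paint-towards-embedded I₁ red Uv Up (Admissible-tree pv)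

  paint-pair : ∀ {c φ U A} → Invariant c φ U A → ∀ {a₁ a₂ b} → U a₁ ≡ true → U a₂ ≡ true → U b ≡ false →
    Admissible a₁ red b → part F a₂ ≢ part F b →
    Invariant (paint red (φ b) (φ a₁) (paint blue (φ b) (φ a₂) c)) φ U (A ∪ a₁ ⇢ b ∪ a₂ ⇢ b)
  paint-pair I Ua₁ Ua₂ Ub adm₁ a₂≁b =
    weaken (paint-towards-embedded (paint-towards-embedded I blue Ua₂ Ub (Admissible-apart a₂≁b)) red Ua₁ Ub adm₁) λ where
      _ (inj₁ (inj₁ α))  → inj₁ α
      _ (inj₁ (inj₂ e₂)) → inj₂ (inj₂ e₂)
      _ (inj₂ e₁)        → inj₂ (inj₁ e₁)

  module PendantPair {c φ U A} (I : Invariant c φ U A) {i j} (s : Slot U i) (s′ : Slot U j) (i≢j : i ≢ j) where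
    open Slot s
    open Slot s′ using () renaming (v to w; p to q; Uv to Uw; pv to pw; Up to Uq; part-v to part-w; part-p to part-q)

    red-to-p : Colouring n
    red-to-p = paint red (φ p) (φ v) (paint blue (φ q) (φ v) c)

    red-to-q : Colouring n
    red-to-q = paint red (φ q) (φ v) (paint blue (φ p) (φ v) c)

    offer : ∀ {t} → ¬ A v p → ¬ A v q → ¬ A v w → Swappable A v w →
      (Invariant red-to-p φ (remove U v) A → Forced t red-to-p) →
      (Invariant red-to-q (φ ∘ transpose v w) (remove U w) (A ⟨ v ↔ w ⟩) → Forced t red-to-q) →
      Forced (suc t) c
    offer ¬Avp ¬Avq ¬Avw safe K₁ K₂ =
      step (φ p) (φ v) (φ q) (φ v) (≢-placed I (pending≢embedded {U} Uv Up ∘ sym)) (≢-placed I (pending≢embedded {U} Uv Uq ∘ sym))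
        distinct (free-unless-allowed′ I Uv ¬Avp) (free-unless-allowed′ I Uv ¬Avq)
        (K₁ (embed-pendant I Uv pv Up Uq (λ v∼q → i≢j (trans (sym part-v) (trans v∼q part-q)))))
        (K₂ (subst (λ c′ → Invariant c′ (φ ∘ transpose v w) (remove U w) (A ⟨ v ↔ w ⟩)) same-board
               (embed-pendant I′ Uw pw Uq Up (λ w∼p → i≢j (trans (sym part-p) (trans (sym w∼p) part-w))))))
      where
        open Invariant I using (injective)
        I′ = relabel-allowed I (λ v≡w → i≢j (trans (sym part-v) (trans (cong (part F) v≡w) part-w))) Uv Uw ¬Avw safe
        distinct : ¬ SameEdge (φ p) (φ v) (φ q) (φ v)
        distinct (inj₁ (p≡q , _)) = i≢j (trans (sym part-p) (trans (cong (part F) (injective p≡q)) part-q))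
        distinct (inj₂ (p≡v , _)) = pending≢embedded {U} Uv Up (sym (injective p≡v))
        same-board : paint red (φ (transpose v w q)) (φ (transpose v w w)) (paint blue (φ (transpose v w p)) (φ (transpose v w w)) c) ≡ red-to-q
        same-board = paint²-cong c (placed-fixed I Uv Uw Uq) (cong φ (transpose-at-j v w))
                                   (placed-fixed I Uv Uw Up) (cong φ (transpose-at-j v w))

  module ForcedPair {c φ U A} (I : Invariant c φ U A) {i} (s : Slot U i) {u} (Uu : U u ≡ true) (u≁i : part F u ≢ i) where
    open Slot s

    red-to-v : Colouring n
    red-to-v = paint red (φ p) (φ v) (paint blue (φ p) (φ u) c)

    red-to-u : Colouring n
    red-to-u = paint red (φ p) (φ u) (paint blue (φ p) (φ v) c)

    offer : ∀ {t} → ¬ A v p → ¬ A u p → ¬ A v u → Swappable A v u →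
      (Invariant red-to-v φ (remove U v) (A ∪ u ⇢ p) → Forced t red-to-v) →
      (Invariant red-to-u (φ ∘ transpose v u) (remove U v) (A ⟨ v ↔ u ⟩ ∪ u ⇢ p) →
        Forced t red-to-u) →
      Forced (suc t) c
    offer ¬Avp ¬Aup ¬Avu safe K₁ K₂ =
      step (φ p) (φ v) (φ p) (φ u) (≢-placed I (pending≢embedded {U} Uv Up ∘ sym)) (≢-placed I (pending≢embedded {U} Uu Up ∘ sym))
        distinct (free-unless-allowed′ I Uv ¬Avp) (free-unless-allowed′ I Uu ¬Aup)
        (K₁ (embed-beside I Uv pv Up Uu u≁v))
        (K₂ (subst (λ c′ → Invariant c′ (φ ∘ transpose v u) (remove U v) (A ⟨ v ↔ u ⟩ ∪ u ⇢ p)) same-board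
               (embed-beside I′ Uv pv Up Uu u≁v)))
      where
        open Invariant I using (injective)
        u≁v : part F u ≢ part F v
        u≁v u∼v = u≁i (trans u∼v part-v)
        I′ = relabel-allowed I (λ v≡u → u≁v (cong (part F) (sym v≡u))) Uv Uu ¬Avu safe
        distinct : ¬ SameEdge (φ p) (φ v) (φ p) (φ u)
        distinct (inj₁ (_ , v≡u)) = u≁v (cong (part F) (sym (injective v≡u)))
        distinct (inj₂ (p≡u , _)) = pending≢embedded {U} Uu Up (sym (injective p≡u))
        same-board : paint red (φ (transpose v u p)) (φ (transpose v u v)) (paint blue (φ (transpose v u p)) (φ (transpose v u u)) c) ≡ red-to-u
        same-board = paint²-cong c (placed-fixed I Uv Uu Up) (cong φ (transpose-at-i v u))
                                   (placed-fixed I Uv Uu Up) (cong φ (transpose-at-j v u))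

  module PairAt {c φ U A} (I : Invariant c φ U A) {a₁ a₂ b} (Ua₁ : U a₁ ≡ true) (Ua₂ : U a₂ ≡ true) (Ub : U b ≡ false)
                (a₁≢a₂ : a₁ ≢ a₂) where

    red-to-a₁ : Colouring n
    red-to-a₁ = paint red (φ b) (φ a₁) (paint blue (φ b) (φ a₂) c)

    red-to-a₂ : Colouring n
    red-to-a₂ = paint red (φ b) (φ a₂) (paint blue (φ b) (φ a₁) c)

    offer : ∀ {t} → Admissible a₁ red b → part F a₂ ≢ part F b → ¬ A a₁ b → ¬ A a₂ b → ¬ A a₁ a₂ → Swappable A a₁ a₂ →
      (Invariant red-to-a₁ φ U (A ∪ a₁ ⇢ b ∪ a₂ ⇢ b) → Forced t red-to-a₁) →
      (Invariant red-to-a₂ (φ ∘ transpose a₁ a₂) U (A ⟨ a₁ ↔ a₂ ⟩ ∪ a₁ ⇢ b ∪ a₂ ⇢ b) →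
        Forced t red-to-a₂) →
      Forced (suc t) c
    offer adm₁ a₂≁b ¬A₁ ¬A₂ ¬A₁₂ safe K₁ K₂ =
      step (φ b) (φ a₁) (φ b) (φ a₂) (≢-placed I (pending≢embedded {U} Ua₁ Ub ∘ sym)) (≢-placed I (pending≢embedded {U} Ua₂ Ub ∘ sym))
        distinct (free-unless-allowed′ I Ua₁ ¬A₁) (free-unless-allowed′ I Ua₂ ¬A₂)
        (K₁ (paint-pair I Ua₁ Ua₂ Ub adm₁ a₂≁b))
        (K₂ (subst (λ c′ → Invariant c′ (φ ∘ transpose a₁ a₂) U (A ⟨ a₁ ↔ a₂ ⟩ ∪ a₁ ⇢ b ∪ a₂ ⇢ b)) same-board
               (paint-pair I′ Ua₁ Ua₂ Ub adm₁ a₂≁b)))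
      where
        open Invariant I using (injective)
        I′ = relabel-allowed I a₁≢a₂ Ua₁ Ua₂ ¬A₁₂ safe
        distinct : ¬ SameEdge (φ b) (φ a₁) (φ b) (φ a₂)
        distinct (inj₁ (_ , a₁≡a₂)) = a₁≢a₂ (injective a₁≡a₂)
        distinct (inj₂ (b≡a₂ , _))  = pending≢embedded {U} Ua₂ Ub (sym (injective b≡a₂))
        same-board : paint red (φ (transpose a₁ a₂ b)) (φ (transpose a₁ a₂ a₁)) (paint blue (φ (transpose a₁ a₂ b)) (φ (transpose a₁ a₂ a₂)) c) ≡ red-to-a₂
        same-board = paint²-cong c (placed-fixed I Ua₁ Ua₂ Ub) (cong φ (transpose-at-i a₁ a₂))
                                   (placed-fixed I Ua₁ Ua₂ Ub) (cong φ (transpose-at-j a₁ a₂))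

  module _ {c φ U A} (I : Invariant c φ U A) where
    open Invariant I

    goal-reached : (∀ x → U x ≡ false) → Goal F ρ c
    goal-reached embedded =
      φ , injective , (λ v w pv → tree-red (embedded v) pv) , roots-placed
        , (λ r r′ root root′ r≢r′ → subst₂ (λ x y → c x y ≡ free) (roots-placed r root) (roots-placed r′ root′)
                                            (roots-free root root′ r≢r′))
        , (λ x y same → proj₁ (admissible x y same)) , (λ x y same → proj₂ (admissible x y same))

    paint²-untouched : ∀ {k₁ k₂ a₁ b₁ a₂ b₂ x} y → x ≢ a₁ → x ≢ b₁ → x ≢ a₂ → x ≢ b₂ →
      paint k₁ (φ a₁) (φ b₁) (paint k₂ (φ a₂) (φ b₂) c) (φ x) y ≡ c (φ x) y
    paint²-untouched {k₁} {k₂} {a₁} {b₁} {a₂} {b₂} y x≢a₁ x≢b₁ x≢a₂ x≢b₂ =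
      trans (paint-untouched k₁ (φ a₁) (φ b₁) (paint k₂ (φ a₂) (φ b₂) c) {y = y} (≢-placed I x≢a₁) (≢-placed I x≢b₁))
            (paint-untouched k₂ (φ a₂) (φ b₂) c {y = y} (≢-placed I x≢a₂) (≢-placed I x≢b₂))

    paint²-untouched′ : ∀ {k₁ k₂ a₁ b₁ a₂ b₂ y} x → y ≢ a₁ → y ≢ b₁ → y ≢ a₂ → y ≢ b₂ →
      paint k₁ (φ a₁) (φ b₁) (paint k₂ (φ a₂) (φ b₂) c) x (φ y) ≡ c x (φ y)
    paint²-untouched′ {k₁} {k₂} {a₁} {b₁} {a₂} {b₂} x y≢a₁ y≢b₁ y≢a₂ y≢b₂ =
      trans (paint-untouched′ k₁ (φ a₁) (φ b₁) (paint k₂ (φ a₂) (φ b₂) c) {x = x} (≢-placed I y≢a₁) (≢-placed I y≢b₁))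
            (paint-untouched′ k₂ (φ a₂) (φ b₂) c {x = x} (≢-placed I y≢a₂) (≢-placed I y≢b₂))

  module _ {c φ U A} (I : Invariant c φ U A) where

    embed-last-two : ∀ {v₀ p₀ d q} → U v₀ ≡ true → parent F v₀ ≡ just p₀ → U p₀ ≡ false →
      U d ≡ true → parent F d ≡ just q → U q ≡ false → part F v₀ ≢ part F q → p₀ ≢ q →
      c (φ v₀) (φ p₀) ≡ red → (∀ x → U x ≡ true → x ≡ v₀ ⊎ x ≡ d) →
      Goal F ρ (paint red (φ q) (φ d) (paint blue (φ q) (φ v₀) c))
    embed-last-two {v₀} {p₀} {d} {q} Uv₀ pv₀ Up₀ Ud pd Uq v₀≁q p₀≢q red-v₀ only =
      goal-reached I₂ all-embedded
      where
        v₀≁d : part F v₀ ≢ part F d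
        v₀≁d v₀∼d = v₀≁q (trans v₀∼d (samePart F d q pd))
        I₁ = embed-beside I Ud pd Uq Uv₀ v₀≁d
        still-red : paint red (φ q) (φ d) (paint blue (φ q) (φ v₀) c) (φ v₀) (φ p₀) ≡ red
        still-red = trans (paint²-untouched′ I (φ v₀) p₀≢q (pending≢embedded {U} Ud Up₀ ∘ sym) p₀≢q
                                              (pending≢embedded {U} Uv₀ Up₀ ∘ sym)) red-v₀
        I₂ = embed I₁ (trans (remove-other U (v₀≁d ∘ cong (part F))) Uv₀) pv₀ (remove-false U d Up₀) still-red
        all-embedded : ∀ x → remove (remove U d) v₀ x ≡ false
        all-embedded x with U x in Ux
        ... | false = remove-false _ v₀ (remove-false U d Ux)
        ... | true with only x Ux
        ...   | inj₁ refl = remove-at _ v₀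
        ...   | inj₂ refl = remove-false _ v₀ (remove-at U d)

  Towards : Fin n → Allowed
  Towards p₀ _ y = y ≡ p₀

  -- p₀ has red edges to the places of v₀ and of d, and v₀ is the only pending
  -- vertex in the part of p₀; the place that does not become v₀ is used for d.
  record Doubled (c : Colouring n) (φ : Fin n → Fin n) (U : Fin n → Bool) (p₀ v₀ d : Fin n) : Set where
    field
      Uv₀    : U v₀ ≡ true
      pv₀    : parent F v₀ ≡ just p₀
      Up₀    : U p₀ ≡ false
      alone  : #pending U (part F p₀) ≤ 1
      Ud     : U d ≡ true
      d≁p₀   : part F d ≢ part F p₀
      red-v₀ : c (φ p₀) (φ v₀) ≡ red
      red-d  : c (φ p₀) (φ d) ≡ red

    v₀∼p₀ : part F v₀ ≡ part F p₀
    v₀∼p₀ = samePart F v₀ p₀ pv₀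

  module _ {c φ U p₀ v₀ d} (D : Doubled c φ U p₀ v₀ d) where
    open Doubled D

    Doubled-embed : ∀ {v} → U v ≡ true → part F v ≢ part F p₀ → v ≢ d → (c′ : Colouring n) →
      c′ (φ p₀) (φ v₀) ≡ c (φ p₀) (φ v₀) → c′ (φ p₀) (φ d) ≡ c (φ p₀) (φ d) → Doubled c′ φ (remove U v) p₀ v₀ d
    Doubled-embed {v} Uv v≁p₀ v≢d c′ same-v₀ same-d = record
      { Uv₀ = trans (remove-other U λ v₀≡v → v≁p₀ (trans (cong (part F) (sym v₀≡v)) v₀∼p₀)) Uv₀
      ; pv₀ = pv₀ ; Up₀ = remove-false U v Up₀
      ; alone = ≤-trans (≤-reflexive (#pending-remove Uv (part F p₀))) (≤-trans (decrement-≤ (#pending U) (part F v) (part F p₀)) alone)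
      ; Ud = trans (remove-other U (v≢d ∘ sym)) Ud ; d≁p₀ = d≁p₀
      ; red-v₀ = trans same-v₀ red-v₀ ; red-d = trans same-d red-d }

    Doubled-relabel : ∀ {v w} → U v ≡ true → U w ≡ true → part F v ≢ part F p₀ → part F w ≢ part F p₀ →
      Doubled c (φ ∘ transpose v w) U p₀ v₀ (transpose v w d)
    Doubled-relabel {v} {w} Uv Uw v≁p₀ w≁p₀ = record
      { Uv₀ = Uv₀ ; pv₀ = pv₀ ; Up₀ = Up₀ ; alone = alone
      ; Ud = transpose-preserves v w (λ x → U x ≡ true) Uv Uw Ud
      ; d≁p₀ = transpose-preserves v w (λ x → part F x ≢ part F p₀) v≁p₀ w≁p₀ d≁p₀
      ; red-v₀ = trans (cong₂ c p₀-fixed (cong φ v₀-fixed)) red-v₀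
      ; red-d = trans (cong₂ c p₀-fixed (cong φ (transpose-involutive v w d))) red-d }
      where
        p₀-fixed : φ (transpose v w p₀) ≡ φ p₀
        p₀-fixed = cong φ (transpose-other v w (pending≢embedded {U} Uv Up₀ ∘ sym) (pending≢embedded {U} Uw Up₀ ∘ sym))
        v₀-fixed : transpose v w v₀ ≡ v₀
        v₀-fixed = transpose-other v w (λ v₀≡v → v≁p₀ (trans (cong (part F) (sym v₀≡v)) v₀∼p₀))
                                       (λ v₀≡w → w≁p₀ (trans (cong (part F) (sym v₀≡w)) v₀∼p₀))

  final-round : ∀ {c φ U p₀ v₀ d q} → Invariant c φ U (Towards p₀) → Doubled c φ U p₀ v₀ d →
    parent F d ≡ just q → U q ≡ false → (∀ x → U x ≡ true → x ≡ v₀ ⊎ x ≡ d) → Forced 1 c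
  final-round {c} {φ} {U} {p₀} {v₀} {d} {q} I D pd Uq only =
    step (φ q) (φ d) (φ q) (φ v₀) (≢-placed I (pending≢embedded {U} Ud Uq ∘ sym)) (≢-placed I (pending≢embedded {U} Uv₀ Uq ∘ sym))
      distinct (free-unless-allowed′ I Ud q≢p₀) (free-unless-allowed′ I Uv₀ q≢p₀)
      (done (embed-last-two I Uv₀ pv₀ Up₀ Ud pd Uq v₀≁q p₀≢q (trans (symmetric _ _) red-v₀) only))
      (done (subst (Goal F ρ) same-board
        (embed-last-two I′ Uv₀ pv₀ Up₀ Ud pd Uq v₀≁q p₀≢q v₀-now-red only)))
    where
      open Invariant I
      open Doubled D
      d∼q : part F d ≡ part F q
      d∼q = samePart F d q pd
      q≢p₀ : q ≢ p₀
      q≢p₀ q≡p₀ = d≁p₀ (trans d∼q (cong (part F) q≡p₀))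
      p₀≢q : p₀ ≢ q
      p₀≢q = q≢p₀ ∘ sym
      v₀≁q : part F v₀ ≢ part F q
      v₀≁q v₀∼q = d≁p₀ (trans d∼q (trans (sym v₀∼q) v₀∼p₀))
      d≢v₀ : d ≢ v₀
      d≢v₀ d≡v₀ = d≁p₀ (trans (cong (part F) d≡v₀) v₀∼p₀)
      distinct : ¬ SameEdge (φ q) (φ d) (φ q) (φ v₀)
      distinct (inj₁ (_ , d≡v₀)) = d≢v₀ (injective d≡v₀)
      distinct (inj₂ (q≡v₀ , _)) = pending≢embedded {U} Uv₀ Uq (sym (injective q≡v₀))
      adm-d : ∀ y → y ≢ d → y ≢ v₀ → Admissible d (c (φ v₀) (φ y)) y
      adm-d y _ _ with free? (c (φ v₀) (φ y))
      ... | yes isFree = subst (λ k → Admissible d k y) (sym isFree) Admissible-free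
      ... | no ¬free with pending-allowed y Uv₀ ¬free
      ...   | refl = Admissible-apart d≁p₀
      adm-v₀ : ∀ y → y ≢ d → y ≢ v₀ → Admissible v₀ (c (φ d) (φ y)) y
      adm-v₀ y _ _ with free? (c (φ d) (φ y))
      ... | yes isFree = subst (λ k → Admissible v₀ k y) (sym isFree) Admissible-free
      ... | no ¬free with pending-allowed y Ud ¬free
      ...   | refl = subst (λ k → Admissible v₀ k p₀) (sym (trans (symmetric _ _) red-d)) (Admissible-tree pv₀)
      I′ = relabel I d≢v₀ Ud Uv₀ (free-unless-allowed I Ud (pending≢embedded {U} Uv₀ Up₀)) adm-d adm-v₀
      v₀-now-red : c (φ (transpose d v₀ v₀)) (φ (transpose d v₀ p₀)) ≡ red
      v₀-now-red = trans (cong₂ c (cong φ (transpose-at-j d v₀)) (placed-fixed I Ud Uv₀ Up₀)) (trans (symmetric _ _) red-d)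
      same-board : paint red (φ (transpose d v₀ q)) (φ (transpose d v₀ d)) (paint blue (φ (transpose d v₀ q)) (φ (transpose d v₀ v₀)) c)
                 ≡ paint red (φ q) (φ v₀) (paint blue (φ q) (φ d) c)
      same-board = paint²-cong c (placed-fixed I Ud Uv₀ Uq) (cong φ (transpose-at-i d v₀))
                                 (placed-fixed I Ud Uv₀ Uq) (cong φ (transpose-at-j d v₀))

  only-two-pending : ∀ {c φ U p₀ v₀ d} → Doubled c φ U p₀ v₀ d → (∀ j → #pending U j ≤ 1) →
    sumF (#pending U) ≡ 2 → ∀ x → U x ≡ true → x ≡ v₀ ⊎ x ≡ d
  only-two-pending {U = U} {p₀} {v₀} {d} D ≤1 total x Ux with part F x ≟ part F p₀ | part F x ≟ part F d
  ... | yes x∼p₀ | _        = inj₁ (pending-unique alone Ux Uv₀ x∼p₀ v₀∼p₀) where open Doubled D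
  ... | no _     | yes x∼d  = inj₂ (pending-unique (≤1 _) Ux Ud x∼d refl) where open Doubled D
  ... | no x≁p₀  | no x≁d   = contradiction (begin
      3                                                                 ≤⟨ +-mono-≤ (+-mono-≤ (#pending-pos Uv₀) (#pending-pos Ud)) (#pending-pos Ux) ⟩
      #pending U (part F v₀) + #pending U (part F d) + #pending U (part F x) ≤⟨ f+f+f≤sumF (#pending U) v₀≁d v₀≁x d≁x ⟩
      sumF (#pending U)                                                 ≡⟨ total ⟩
      2                                                                 ∎) λ { (s≤s (s≤s ())) }
    where
      open Doubled D
      open ≤-Reasoning
      v₀≁d : part F v₀ ≢ part F d
      v₀≁d v₀∼d = d≁p₀ (trans (sym v₀∼d) v₀∼p₀)
      v₀≁x : part F v₀ ≢ part F x
      v₀≁x v₀∼x = x≁p₀ (trans (sym v₀∼x) v₀∼p₀)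
      d≁x : part F d ≢ part F x
      d≁x d∼x = x≁d (sym d∼x)

  EndgameFrom : ℕ → Fin n → Fin n → Set
  EndgameFrom s p₀ v₀ = ∀ {c φ U d} → Invariant c φ U (Towards p₀) → Doubled c φ U p₀ v₀ d →
    (∀ j → #pending U j ≤ 1) → sumF (#pending U) ≡ 2 + s → Forced (suc s) c

  pendant-step : ∀ {s c φ U A p₀ v₀ d i j} → EndgameFrom s p₀ v₀ →
    Invariant c φ U A → Doubled c φ U p₀ v₀ d → (∀ j → #pending U j ≤ 1) → sumF (#pending U) ≡ 3 + s →
    (t : Slot U i) (t′ : Slot U j) → i ≢ j → i ≢ part F p₀ → j ≢ part F p₀ → Slot.v t ≢ d →
    ¬ A (Slot.v t) (Slot.p t) → ¬ A (Slot.v t) (Slot.p t′) → ¬ A (Slot.v t) (Slot.v t′) → Swappable A (Slot.v t) (Slot.v t′) →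
    (∀ {z y} → remove U (Slot.v t) z ≡ true → A z y → y ≡ p₀) →
    (∀ {z y} → remove U (Slot.v t′) z ≡ true → (A ⟨ Slot.v t ↔ Slot.v t′ ⟩) z y → y ≡ p₀) →
    Forced (suc (suc s)) c
  pendant-step {s} {c} {φ} {U} {A} {p₀} {v₀} {d} {i} {j} continue I D ≤1 total t t′ i≢j i≁p₀ j≁p₀ v≢d
               ¬Avp ¬Avq ¬Avw safe back₁ back₂ =
    PendantPair.offer I t t′ i≢j ¬Avp ¬Avq ¬Avw safe
      (λ I₁ → continue (weaken I₁ back₁) (Doubled-embed D Uv v≁p₀ v≢d red-to-p (unchanged-p _) (unchanged-p _))
                       (#pending-remove-≤1 Uv ≤1) (suc-injective (trans (sumF-#pending-remove Uv) total)))
      (λ I₂ → continue (weaken I₂ back₂)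
                       (Doubled-embed (Doubled-relabel D Uv Uw v≁p₀ w≁p₀) Uw w≁p₀ w≢d′ red-to-q (unchanged-q _) (unchanged-q _))
                       (#pending-remove-≤1 Uw ≤1) (suc-injective (trans (sumF-#pending-remove Uw) total)))
    where
      open Doubled D
      open Slot t
      open Slot t′ using () renaming (v to w; p to q; Uv to Uw; part-v to part-w; part-p to part-q)
      open PendantPair I t t′ i≢j using (red-to-p; red-to-q)
      v≁p₀ : part F v ≢ part F p₀
      v≁p₀ v∼p₀ = i≁p₀ (trans (sym part-v) v∼p₀)
      w≁p₀ : part F w ≢ part F p₀
      w≁p₀ w∼p₀ = j≁p₀ (trans (sym part-w) w∼p₀)
      p₀≢p : p₀ ≢ p
      p₀≢p p₀≡p = i≁p₀ (trans (sym part-p) (cong (part F) (sym p₀≡p)))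
      p₀≢q : p₀ ≢ q
      p₀≢q p₀≡q = j≁p₀ (trans (sym part-q) (cong (part F) (sym p₀≡q)))
      p₀≢v : p₀ ≢ v
      p₀≢v = pending≢embedded {U} Uv Up₀ ∘ sym
      w≢d′ : w ≢ transpose v w d
      w≢d′ with transpose-view v w d
      ... | at-i d≡v _    = λ _ → v≢d (sym d≡v)
      ... | at-j _ e      = λ w≡d′ → i≢j (trans (sym part-v) (trans (cong (part F) (sym (trans w≡d′ e))) part-w))
      ... | other _ d≢w e = λ w≡d′ → d≢w (sym (trans w≡d′ e))
      p₀-fixed : φ (transpose v w p₀) ≡ φ p₀
      p₀-fixed = placed-fixed I Uv Uw Up₀
      unchanged-p : ∀ y → red-to-p (φ p₀) y ≡ c (φ p₀) y
      unchanged-p y = paint²-untouched I y p₀≢p p₀≢v p₀≢q p₀≢v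
      unchanged-q : ∀ y → red-to-q (φ (transpose v w p₀)) y ≡ c (φ (transpose v w p₀)) y
      unchanged-q y = trans (cong (λ x → red-to-q x y) p₀-fixed)
        (trans (paint²-untouched I y p₀≢q p₀≢v p₀≢p p₀≢v) (cong (λ x → c x y) (sym p₀-fixed)))

  endgame : ∀ s {p₀ v₀} → EndgameFrom s p₀ v₀
  endgame zero {d = d} I D ≤1 total =
    final-round I D (subst (λ x → parent F x ≡ just (Slot.p sd)) sd≡d (Slot.pv sd)) (Slot.Up sd)
                (only-two-pending D ≤1 total)
    where
      open Doubled D
      sd = slot (Invariant.roots-embedded I) (part F d) (#pending-pos Ud)
      sd≡d : Slot.v sd ≡ d
      sd≡d = pending-unique (≤1 _) (Slot.Uv sd) Ud (Slot.part-v sd) refl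
  endgame (suc s) {p₀} {v₀} {c} {φ} {U} {d} I D ≤1 total =
    from-parts (other-nonzero (#pending U) 2 ≤1 (subst (λ j → 1 ≤ #pending U j) v₀∼p₀ (#pending-pos Uv₀))
                       (≤-trans (s≤s (s≤s (s≤s z≤n))) (≤-reflexive (sym total))))
    where
      open Doubled D
      open Invariant I using (roots-embedded)

      offer-from : ∀ {i j} (t : Slot U i) (t′ : Slot U j) → i ≢ j → i ≢ part F p₀ → j ≢ part F p₀ →
        Slot.v t ≢ d → Forced (suc (suc s)) c
      offer-from t t′ i≢j i≁p₀ j≁p₀ v≢d =
        pendant-step (endgame s) I D ≤1 total t t′ i≢j i≁p₀ j≁p₀ v≢d
          (λ p≡p₀ → i≁p₀ (trans (sym (Slot.part-p t)) (cong (part F) p≡p₀)))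
          (λ q≡p₀ → j≁p₀ (trans (sym (Slot.part-p t′)) (cong (part F) q≡p₀)))
          (pending≢embedded {U} (Slot.Uv t′) Up₀)
          (λ { _ refl → (λ v∼p₀ → i≁p₀ (trans (sym (Slot.part-v t)) v∼p₀))
                      , (λ w∼p₀ → j≁p₀ (trans (sym (Slot.part-v t′)) w∼p₀)) })
          (λ _ y≡p₀ → y≡p₀)
          (λ _ → transpose-fixed⁻¹ (Slot.v t) (Slot.v t′) (pending≢embedded {U} (Slot.Uv t) Up₀ ∘ sym)
                                                          (pending≢embedded {U} (Slot.Uv t′) Up₀ ∘ sym))

      choose : ∀ {i j} (t : Slot U i) (t′ : Slot U j) → i ≢ j → i ≢ part F p₀ → j ≢ part F p₀ → Forced (suc (suc s)) c
      choose t t′ i≢j i≁p₀ j≁p₀ with Slot.v t ≟ d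
      ... | no v≢d  = offer-from t t′ i≢j i≁p₀ j≁p₀ v≢d
      ... | yes v≡d = offer-from t′ t (i≢j ∘ sym) j≁p₀ i≁p₀ λ v′≡d →
        i≢j (trans (sym (Slot.part-v t)) (trans (cong (part F) (trans v≡d (sym v′≡d))) (Slot.part-v t′)))

      from-parts : (Σ (Fin 2 → Fin ℓ) λ w → (∀ {x y} → w x ≡ w y → x ≡ y) × (∀ x → w x ≢ part F p₀ × 1 ≤ #pending U (w x))) →
        Forced (suc (suc s)) c
      from-parts (w , w-inj , outside) =
        choose (slot roots-embedded (w 0F) (proj₂ (outside 0F))) (slot roots-embedded (w 1F) (proj₂ (outside 1F)))
               (λ e → 0≢1+n (w-inj e)) (proj₁ (outside 0F)) (proj₁ (outside 1F))

  None : Allowed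
  None _ _ = ⊥

  -- Two rounds giving p₀ red edges to the places of v₀ and u₂; u₁ and u₃
  -- only serve as alternatives offered alongside them.
  module Doubling {U j₀} (s₀ : Slot U j₀) {u₁ u₂ u₃} (Uu₁ : U u₁ ≡ true) (Uu₂ : U u₂ ≡ true) (Uu₃ : U u₃ ≡ true)
                  (u₁≁j₀ : part F u₁ ≢ j₀) (u₂≁j₀ : part F u₂ ≢ j₀) (u₃≁j₀ : part F u₃ ≢ j₀)
                  (u₁≁u₂ : part F u₁ ≢ part F u₂) (u₁≁u₃ : part F u₁ ≢ part F u₃) (u₂≁u₃ : part F u₂ ≢ part F u₃)
                  (alone : #pending U j₀ ≤ 1) {t : ℕ}
                  (K : ∀ {c′ φ′} → Invariant c′ φ′ U (Towards (Slot.p s₀)) →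
                       Doubled c′ φ′ U (Slot.p s₀) (Slot.v s₀) u₂ → Forced t c′) where
    open Slot s₀ using () renaming (v to v₀; p to p₀; Uv to Uv₀; pv to pv₀; Up to Up₀; part-v to part-v₀; part-p to part-p₀)

    private
      v₀≢ : ∀ {x} → part F x ≢ j₀ → v₀ ≢ x
      v₀≢ x≁j₀ v₀≡x = x≁j₀ (trans (cong (part F) (sym v₀≡x)) part-v₀)
      ≁p₀ : ∀ {x} → part F x ≢ j₀ → part F x ≢ part F p₀
      ≁p₀ x≁j₀ x∼p₀ = x≁j₀ (trans x∼p₀ part-p₀)
      p₀≢ : ∀ {x} → U x ≡ true → p₀ ≢ x
      p₀≢ Ux = pending≢embedded {U} Ux Up₀ ∘ sym

      A₁ : Allowed
      A₁ = None ∪ v₀ ⇢ p₀ ∪ u₁ ⇢ p₀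

      not-earlier : ∀ {x y} → part F x ≢ j₀ → part F x ≢ part F u₁ → ¬ A₁ x y
      not-earlier x≁j₀ _ (inj₂ (inj₁ (x≡v₀ , _)))  = v₀≢ x≁j₀ (sym x≡v₀)
      not-earlier _ x≁u₁ (inj₂ (inj₂ (x≡u₁ , _))) = x≁u₁ (cong (part F) x≡u₁)

      towards : ∀ {z y} → (A₁ ∪ u₂ ⇢ p₀ ∪ u₃ ⇢ p₀) z y → y ≡ p₀
      towards (inj₁ (inj₂ (inj₁ (_ , y≡p₀)))) = y≡p₀
      towards (inj₁ (inj₂ (inj₂ (_ , y≡p₀)))) = y≡p₀
      towards (inj₂ (inj₁ (_ , y≡p₀)))        = y≡p₀
      towards (inj₂ (inj₂ (_ , y≡p₀)))        = y≡p₀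

      towards′ : ∀ {z y} → (A₁ ⟨ u₂ ↔ u₃ ⟩ ∪ u₂ ⇢ p₀ ∪ u₃ ⇢ p₀) z y → y ≡ p₀
      towards′ (inj₁ a) = transpose-fixed⁻¹ u₂ u₃ (p₀≢ Uu₂) (p₀≢ Uu₃) (towards (inj₁ a))
      towards′ (inj₂ a) = towards (inj₂ a)

      doubled : ∀ {c′ φ′} → c′ (φ′ p₀) (φ′ v₀) ≡ red → c′ (φ′ p₀) (φ′ u₂) ≡ red → Doubled c′ φ′ U p₀ v₀ u₂
      doubled red-v₀ red-u₂ = record
        { Uv₀ = Uv₀ ; pv₀ = pv₀ ; Up₀ = Up₀ ; alone = subst (λ j → #pending U j ≤ 1) (sym part-p₀) alone
        ; Ud = Uu₂ ; d≁p₀ = ≁p₀ u₂≁j₀ ; red-v₀ = red-v₀ ; red-d = red-u₂ }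

    second-round : ∀ {c₁ φ₁} → Invariant c₁ φ₁ U A₁ → c₁ (φ₁ p₀) (φ₁ v₀) ≡ red → Forced (suc t) c₁
    second-round {c₁} {φ₁} I₁ red-v₀ =
      PairAt.offer I₁ Uu₂ Uu₃ Up₀ (u₂≁u₃ ∘ cong (part F)) (Admissible-apart (≁p₀ u₂≁j₀)) (≁p₀ u₃≁j₀)
        (not-earlier u₂≁j₀ (u₁≁u₂ ∘ sym)) (not-earlier u₃≁j₀ (u₁≁u₃ ∘ sym)) (not-earlier u₂≁j₀ (u₁≁u₂ ∘ sym))
        (λ { (inj₁ refl) a → contradiction a (not-earlier u₂≁j₀ (u₁≁u₂ ∘ sym))
           ; (inj₂ refl) a → contradiction a (not-earlier u₃≁j₀ (u₁≁u₃ ∘ sym)) })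
        (λ I₂ → K (weaken I₂ λ _ → towards)
                  (doubled (unchanged u₂ u₃ (v₀≢ u₂≁j₀) (v₀≢ u₃≁j₀)) (paint-on red (φ₁ p₀) (φ₁ u₂) (paint blue (φ₁ p₀) (φ₁ u₃) c₁) (inj₁ (refl , refl)))))
        (λ I₂ → K (weaken I₂ λ _ → towards′)
                  (doubled (trans (cong₂ red-to-u₃ p₀-fixed (cong φ₁ v₀-fixed)) (unchanged u₃ u₂ (v₀≢ u₃≁j₀) (v₀≢ u₂≁j₀)))
                           (trans (cong₂ red-to-u₃ p₀-fixed (cong φ₁ (transpose-at-i u₂ u₃)))
                                  (paint-on red (φ₁ p₀) (φ₁ u₃) (paint blue (φ₁ p₀) (φ₁ u₂) c₁) (inj₁ (refl , refl))))))
      where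
        red-to-u₃ = paint red (φ₁ p₀) (φ₁ u₃) (paint blue (φ₁ p₀) (φ₁ u₂) c₁)
        p₀-fixed : φ₁ (transpose u₂ u₃ p₀) ≡ φ₁ p₀
        p₀-fixed = placed-fixed I₁ Uu₂ Uu₃ Up₀
        v₀-fixed : transpose u₂ u₃ v₀ ≡ v₀
        v₀-fixed = transpose-other u₂ u₃ (v₀≢ u₂≁j₀) (v₀≢ u₃≁j₀)
        unchanged : ∀ a b → v₀ ≢ a → v₀ ≢ b → paint red (φ₁ p₀) (φ₁ a) (paint blue (φ₁ p₀) (φ₁ b) c₁) (φ₁ p₀) (φ₁ v₀) ≡ red
        unchanged a b v₀≢a v₀≢b = trans (paint²-untouched′ I₁ (φ₁ p₀) (p₀≢ Uv₀ ∘ sym) v₀≢a (p₀≢ Uv₀ ∘ sym) v₀≢b) red-v₀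

    double : ∀ {c φ} → Invariant c φ U None → Forced (suc (suc t)) c
    double {c} {φ} I =
      PairAt.offer I Uv₀ Uu₁ Up₀ (v₀≢ u₁≁j₀) (Admissible-tree pv₀) (≁p₀ u₁≁j₀) (λ ()) (λ ()) (λ ()) (λ _ ())
        (λ I₁ → second-round I₁ (paint-on red (φ p₀) (φ v₀) (paint blue (φ p₀) (φ u₁) c) (inj₁ (refl , refl))))
        (λ I₁ → second-round I₁ (trans (cong₂ (paint red (φ p₀) (φ u₁) (paint blue (φ p₀) (φ v₀) c))
                                              (placed-fixed I Uv₀ Uu₁ Up₀) (cong φ (transpose-at-i v₀ u₁)))
                                       (paint-on red (φ p₀) (φ u₁) (paint blue (φ p₀) (φ v₀) c) (inj₁ (refl , refl)))))

  module _ {U : Fin n → Bool} {j : Fin ℓ} (s : Slot U j) where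
    open Slot s

    slot-remove : ∀ {x} → v ≢ x → Slot (remove U x) j
    slot-remove {x} v≢x = record
      { v = v ; p = p ; Uv = trans (remove-other U v≢x) Uv ; pv = pv ; Up = remove-false U x Up ; part-v = part-v }

  four-singletons : ∀ {c φ U} → Invariant c φ U None → (∀ j → #pending U j ≤ 1) → sumF (#pending U) ≡ 4 → Forced 5 c
  four-singletons {c} {φ} {U} I ≤1 total =
    from-parts (count-witnesses (λ j → not (#pending U j ==ℕ 0)) 4 (≤-reflexive (trans (sym total) (sumF≡#nonzero _ ≤1))))
    where
      from-parts : (Σ (Fin 4 → Fin ℓ) λ w → (∀ {x y} → w x ≡ w y → x ≡ y) × (∀ x → not (#pending U (w x) ==ℕ 0) ≡ true)) → Forced 5 c
      from-parts (w , w-inj , nonzero) =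
        Doubling.double (s 0F) (Slot.Uv (s 1F)) (Slot.Uv (s 2F)) (Slot.Uv (s 3F))
          (apart (λ ())) (apart (λ ())) (apart (λ ())) (apart′ (λ ())) (apart′ (λ ())) (apart′ (λ ()))
          (≤1 (w 0F)) (λ I′ D → endgame 2 I′ D ≤1 total) I
        where
          s : ∀ x → Slot U (w x)
          s x = slot (Invariant.roots-embedded I) (w x) (nonzero⇒pos (nonzero x))
          apart : ∀ {x y} → x ≢ y → part F (Slot.v (s x)) ≢ w y
          apart {x} x≢y e = x≢y (w-inj (trans (sym (Slot.part-v (s x))) e))
          apart′ : ∀ {x y} → x ≢ y → part F (Slot.v (s x)) ≢ part F (Slot.v (s y))
          apart′ {x} {y} x≢y e = apart x≢y (trans e (Slot.part-v (s y)))

  -- With v₀ and d = u₂ doubled, the remaining pending vertices are x (in part i,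
  -- where a second pending vertex waits below it) and u₃.
  module AfterDoubling {c φ U p₀ v₀ i j₂ j₃} (I : Invariant c φ U (Towards p₀))
           (sx : Slot U i) (s₂ : Slot U j₂) (s₃ : Slot U j₃) (D : Doubled c φ U p₀ v₀ (Slot.v s₂))
           (i≢j₂ : i ≢ j₂) (i≢j₃ : i ≢ j₃) (j₂≢j₃ : j₂ ≢ j₃)
           (i≁p₀ : i ≢ part F p₀) (j₂≁p₀ : j₂ ≢ part F p₀) (j₃≁p₀ : j₃ ≢ part F p₀)
           (≤1 : ∀ j → #pending (remove U (Slot.v sx)) j ≤ 1) (total : sumF (#pending U) ≡ 5) where

    open Doubled D
    open Slot sx using () renaming (v to x; p to px; Uv to Ux; Up to Upx; part-v to part-x; part-p to part-px)
    open Slot s₂ using () renaming (v to u₂; p to q₂; Uv to Uu₂; Up to Uq₂; part-v to part-u₂; part-p to part-q₂)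
    open Slot s₃ using () renaming (v to u₃; p to q₃; Uv to Uu₃; Up to Uq₃; part-v to part-u₃; part-p to part-q₃)

    private
      _≉_ : Fin n → Fin n → Set
      a ≉ b = part F a ≢ part F b
      parts : ∀ {a b ja jb} → part F a ≡ ja → part F b ≡ jb → ja ≢ jb → a ≉ b
      parts pa pb ja≢jb a∼b = ja≢jb (trans (sym pa) (trans a∼b pb))
      distinct : ∀ {a b} → a ≉ b → a ≢ b
      distinct a≁b = a≁b ∘ cong (part F)
      p₀≢ : ∀ {a} → U a ≡ true → p₀ ≢ a
      p₀≢ Ua = pending≢embedded {U} Ua Up₀ ∘ sym
      x≁p₀ = parts part-x refl i≁p₀
      u₂≁p₀ = parts part-u₂ refl j₂≁p₀
      u₃≁p₀ = parts part-u₃ refl j₃≁p₀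

    last-pair : ∀ {c′ φ′} → let U′ = remove U x in
      Invariant c′ φ′ U′ (Towards p₀ ∪ u₃ ⇢ px) → Doubled c′ φ′ U′ p₀ v₀ u₂ → Forced 3 c′
    last-pair {c′} {φ′} I′ D′ =
      pendant-step (endgame 1) I′ D′ ≤1 (suc-injective (trans (sumF-#pending-remove Ux) total))
        (slot-remove s₃ (distinct (parts part-u₃ part-x (i≢j₃ ∘ sym))))
        (slot-remove s₂ (distinct (parts part-u₂ part-x (i≢j₂ ∘ sym))))
        (j₂≢j₃ ∘ sym) j₃≁p₀ j₂≁p₀ (distinct (parts part-u₃ part-u₂ (j₂≢j₃ ∘ sym)))
        (not-towards part-q₃ (j₃≁p₀ ∘ sym) i≢j₃) (not-towards part-q₂ (j₂≁p₀ ∘ sym) i≢j₂)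
        (not-towards part-u₂ (j₂≁p₀ ∘ sym) i≢j₂)
        (λ { _ (inj₁ refl) → u₃≁p₀ , u₂≁p₀
           ; (inj₁ refl) (inj₂ (_ , refl)) → parts part-u₃ part-px (i≢j₃ ∘ sym) , parts part-u₂ part-px (i≢j₂ ∘ sym)
           ; (inj₂ refl) (inj₂ (u₂≡u₃ , _)) → contradiction u₂≡u₃ (distinct (parts part-u₂ part-u₃ j₂≢j₃)) })
        (λ { _ (inj₁ y≡p₀) → y≡p₀ ; Uz (inj₂ (refl , _)) → contradiction refl (proj₂ (remove-sound _ u₃ Uz)) })
        (λ { _ (inj₁ τy≡p₀) → transpose-fixed⁻¹ u₃ u₂ (p₀≢ Uu₃) (p₀≢ Uu₂) τy≡p₀
           ; Uz (inj₂ (τz≡u₃ , _)) → contradiction (transpose-to-i u₃ u₂ τz≡u₃) (proj₂ (remove-sound _ u₂ Uz)) })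
      where
        not-towards : ∀ {a ja} → part F a ≡ ja → part F p₀ ≢ ja → i ≢ ja → ¬ (Towards p₀ ∪ u₃ ⇢ px) u₃ a
        not-towards pa p₀≁a _   (inj₁ a≡p₀)      = p₀≁a (trans (cong (part F) (sym a≡p₀)) pa)
        not-towards pa _    i≢a (inj₂ (_ , a≡px)) = i≢a (trans (sym part-px) (trans (cong (part F) (sym a≡px)) pa))

    force-x : Forced 4 c
    force-x = ForcedPair.offer I sx Uu₃ (λ u₃∼i → i≢j₃ (trans (sym u₃∼i) part-u₃))
      px≢p₀ px≢p₀ (p₀≢ Uu₃ ∘ sym) (λ { _ refl → x≁p₀ , u₃≁p₀ })
      (λ I₁ → last-pair I₁ (Doubled-embed D Ux x≁p₀ x≢u₂ red-to-v (unchanged-v _) (unchanged-v _)))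
      (λ I₂ → last-pair (weaken I₂ back)
                (Doubled-embed D₂ Ux x≁p₀ x≢u₂ red-to-u (unchanged-u _) (unchanged-u _)))
      where
        open ForcedPair I sx Uu₃ (λ u₃∼i → i≢j₃ (trans (sym u₃∼i) part-u₃)) using (red-to-v; red-to-u)
        px≢p₀ : px ≢ p₀
        px≢p₀ px≡p₀ = i≁p₀ (trans (sym part-px) (cong (part F) px≡p₀))
        x≢u₂ : x ≢ u₂
        x≢u₂ = distinct (parts part-x part-u₂ i≢j₂)
        p₀≢px : p₀ ≢ px
        p₀≢px = px≢p₀ ∘ sym
        unchanged-v : ∀ y → red-to-v (φ p₀) y ≡ c (φ p₀) y
        unchanged-v y = paint²-untouched I y p₀≢px (p₀≢ Ux) p₀≢px (p₀≢ Uu₃)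
        p₀-fixed : φ (transpose x u₃ p₀) ≡ φ p₀
        p₀-fixed = placed-fixed I Ux Uu₃ Up₀
        unchanged-u : ∀ y → red-to-u (φ (transpose x u₃ p₀)) y ≡ c (φ (transpose x u₃ p₀)) y
        unchanged-u y = trans (cong (λ z → red-to-u z y) p₀-fixed)
          (trans (paint²-untouched I y p₀≢px (p₀≢ Uu₃) p₀≢px (p₀≢ Ux)) (cong (λ z → c z y) (sym p₀-fixed)))
        back : ∀ {z y} → remove U x z ≡ true → (Towards p₀ ⟨ x ↔ u₃ ⟩ ∪ u₃ ⇢ px) z y → (Towards p₀ ∪ u₃ ⇢ px) z y
        back _ (inj₁ τy≡p₀) = inj₁ (transpose-fixed⁻¹ x u₃ (p₀≢ Ux) (p₀≢ Uu₃) τy≡p₀)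
        back _ (inj₂ e)     = inj₂ e
        D₂ : Doubled c (φ ∘ transpose x u₃) U p₀ v₀ u₂
        D₂ = subst (Doubled c (φ ∘ transpose x u₃) U p₀ v₀)
                   (transpose-other x u₃ (x≢u₂ ∘ sym) (distinct (parts part-u₂ part-u₃ j₂≢j₃)))
                   (Doubled-relabel D Ux Uu₃ x≁p₀ u₃≁p₀)

  pair-and-three-singletons : ∀ {c φ U} → Invariant c φ U None → ∀ i → #pending U i ≡ 2 →
    (∀ j → j ≢ i → #pending U j ≤ 1) → sumF (#pending U) ≡ 5 → Forced 6 c
  pair-and-three-singletons {c} {φ} {U} I i two ≤1 total =
    from-parts (other-nonzero (#pending (remove U x)) 3 ≤1′ (≤-reflexive (sym one-left))
                       (≤-reflexive (sym (suc-injective (trans (sumF-#pending-remove Ux) total)))))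
    where
      roots = Invariant.roots-embedded I
      sx = slot roots i (subst (1 ≤_) (sym two) (s≤s z≤n))
      open Slot sx using () renaming (v to x; Uv to Ux; part-v to part-x)
      one-left : #pending (remove U x) i ≡ 1
      one-left = trans (#pending-remove Ux i)
                       (trans (cong (λ j → decrement (#pending U) j i) part-x) (trans (decrement-at (#pending U) i) (cong pred two)))
      ≤1′ : ∀ j → #pending (remove U x) j ≤ 1
      ≤1′ j with j ≟ i
      ... | yes refl = ≤-reflexive one-left
      ... | no j≢i   = ≤-trans (≤-reflexive (#pending-remove Ux j)) (≤-trans (decrement-≤ _ _ j) (≤1 j j≢i))
      from-parts : (Σ (Fin 3 → Fin ℓ) λ w → (∀ {a b} → w a ≡ w b → a ≡ b) × (∀ a → w a ≢ i × 1 ≤ #pending (remove U x) (w a))) →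
        Forced 6 c
      from-parts (w , w-inj , outside) =
        Doubling.double s₀ Ux (Slot.Uv s₂) (Slot.Uv s₃) (λ x∼w₀ → i≢ 0F (trans (sym part-x) x∼w₀)) (apart (λ ())) (apart (λ ()))
          (λ x∼u₂ → i≢ 1F (trans (sym part-x) (trans x∼u₂ (Slot.part-v s₂))))
          (λ x∼u₃ → i≢ 2F (trans (sym part-x) (trans x∼u₃ (Slot.part-v s₃))))
          (λ u₂∼u₃ → apart (λ ()) (trans u₂∼u₃ (Slot.part-v s₃)))
          (≤1 (w 0F) (proj₁ (outside 0F)))
          (λ I′ D → AfterDoubling.force-x I′ sx s₂ s₃ D (i≢ 1F) (i≢ 2F) (w-distinct λ ())
                      (λ i∼p₀ → i≢ 0F (trans i∼p₀ (Slot.part-p s₀))) (≁p₀ λ ()) (≁p₀ λ ()) ≤1′ total)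
          I
        where
          i≢ : ∀ a → i ≢ w a
          i≢ a = proj₁ (outside a) ∘ sym
          w-distinct : ∀ {a b} → a ≢ b → w a ≢ w b
          w-distinct a≢b = a≢b ∘ w-inj
          s : ∀ a → Slot U (w a)
          s a = slot roots (w a) (≤-trans (proj₂ (outside a)) (≤-trans (≤-reflexive (#pending-remove Ux (w a))) (decrement-≤ (#pending U) (part F x) (w a))))
          s₀ = s 0F
          s₂ = s 1F
          s₃ = s 2F
          ≁p₀ : ∀ {a} → a ≢ 0F → w a ≢ part F (Slot.p s₀)
          ≁p₀ a≢0 e = w-distinct a≢0 (trans e (Slot.part-p s₀))
          apart : ∀ {a b} → a ≢ b → part F (Slot.v (s a)) ≢ w b
          apart {a} a≢b e = a≢b (w-inj (trans (sym (Slot.part-v (s a))) e))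

  Suitable⁺-remove : ∀ {U v i} → U v ≡ true → part F v ≡ i →
    Suitable⁺ (decrement (#pending U) i) → Suitable⁺ (#pending (remove U v))
  Suitable⁺-remove Uv refl = Suitable⁺-cong (λ j → sym (#pending-remove Uv j))

  Suitable⁺-remove² : ∀ {U v u i j} → U v ≡ true → remove U v u ≡ true → part F v ≡ i → part F u ≡ j →
    Suitable⁺ (decrement (decrement (#pending U) i) j) → Suitable⁺ (#pending (remove (remove U v) u))
  Suitable⁺-remove² Uv Uu refl refl = Suitable⁺-cong λ k →
    sym (trans (#pending-remove Uu k) (decrement-cong (#pending-remove Uv) _ k))

  Playable : ℕ → Set
  Playable e = ∀ {c φ U} → Invariant c φ U None → Suitable⁺ (#pending U) → sumF (#pending U) ≡ e → Forced (suc e) c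

  offer-pair : ∀ {e c φ U} → Playable e → Invariant c φ U None → sumF (#pending U) ≡ suc e →
    ∀ {i j} → i ≢ j → 1 ≤ #pending U i → 1 ≤ #pending U j →
    Suitable⁺ (decrement (#pending U) i) → Suitable⁺ (decrement (#pending U) j) → Forced (suc (suc e)) c
  offer-pair continue I total {i} {j} i≢j pos-i pos-j good-i good-j =
    PendantPair.offer I sᵢ sⱼ i≢j (λ ()) (λ ()) (λ ()) (λ _ ())
      (λ I₁ → continue I₁ (Suitable⁺-remove (Slot.Uv sᵢ) (Slot.part-v sᵢ) good-i)
                          (suc-injective (trans (sumF-#pending-remove (Slot.Uv sᵢ)) total)))
      (λ I₂ → continue I₂ (Suitable⁺-remove (Slot.Uv sⱼ) (Slot.part-v sⱼ) good-j)
                          (suc-injective (trans (sumF-#pending-remove (Slot.Uv sⱼ)) total)))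
    where
      sᵢ = slot (Invariant.roots-embedded I) i pos-i
      sⱼ = slot (Invariant.roots-embedded I) j pos-j

  force-then-offer-pair : ∀ {e c φ U} → Playable e → Invariant c φ U None → sumF (#pending U) ≡ suc (suc e) →
    ∀ {i j₁ j₂} → i ≢ j₁ → i ≢ j₂ → j₁ ≢ j₂ → 1 ≤ #pending U i → 1 ≤ #pending U j₁ → 1 ≤ #pending U j₂ →
    Suitable⁺ (decrement (decrement (#pending U) i) j₁) → Suitable⁺ (decrement (decrement (#pending U) i) j₂) →
    Forced (suc (suc (suc e))) c
  force-then-offer-pair {e} {U = U} continue I total {i} {j₁} {j₂} i≢j₁ i≢j₂ j₁≢j₂ pos-i pos-j₁ pos-j₂ good₁ good₂ =
    ForcedPair.offer I sᵢ (Slot.Uv s₁) (λ u∼i → i≢j₁ (trans (sym u∼i) part-u))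
      (λ ()) (λ ()) (λ ()) (λ _ ()) then-offer then-offer
    where
      roots = Invariant.roots-embedded I
      sᵢ = slot roots i pos-i
      s₁ = slot roots j₁ pos-j₁
      s₂ = slot roots j₂ pos-j₂
      open Slot sᵢ using (v; p; Uv; Up; part-p)
      open Slot s₁ using () renaming (v to u; part-v to part-u)
      open Slot s₂ using () renaming (v to w; part-v to part-w)
      apart : ∀ {a b ja jb} → part F a ≡ ja → part F b ≡ jb → ja ≢ jb → a ≢ b
      apart pa pb ja≢jb a≡b = ja≢jb (trans (sym pa) (trans (cong (part F) a≡b) pb))
      U₁ = remove U v
      s₁′ = slot-remove s₁ (apart part-u (Slot.part-v sᵢ) (i≢j₁ ∘ sym))
      s₂′ = slot-remove s₂ (apart part-w (Slot.part-v sᵢ) (i≢j₂ ∘ sym))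
      total₁ : sumF (#pending U₁) ≡ suc e
      total₁ = suc-injective (trans (sumF-#pending-remove Uv) total)
      not-to-p : ∀ {x jx} → part F x ≡ jx → i ≢ jx → ¬ (None ∪ u ⇢ p) u x
      not-to-p px i≢jx (inj₂ (_ , x≡p)) = i≢jx (trans (sym part-p) (trans (cong (part F) (sym x≡p)) px))
      then-offer : ∀ {c₁ φ₁} → Invariant c₁ φ₁ U₁ (None ∪ u ⇢ p) → Forced (suc (suc e)) c₁
      then-offer I₁ =
        PendantPair.offer I₁ s₁′ s₂′ j₁≢j₂ (not-to-p (Slot.part-p s₁) i≢j₁) (not-to-p (Slot.part-p s₂) i≢j₂)
          (not-to-p part-w i≢j₂)
          (λ { _ (inj₂ (_ , refl)) → (λ u∼p → i≢j₁ (trans (sym part-p) (trans (sym u∼p) part-u)))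
                                    , (λ w∼p → i≢j₂ (trans (sym part-p) (trans (sym w∼p) part-w))) })
          (λ I₃ → continue (weaken I₃ λ { Uz (inj₂ (z≡u , _)) → contradiction z≡u (proj₂ (remove-sound U₁ u Uz)) })
                    (Suitable⁺-remove² Uv (Slot.Uv s₁′) (Slot.part-v sᵢ) part-u good₁)
                    (suc-injective (trans (sumF-#pending-remove (Slot.Uv s₁′)) total₁)))
          (λ I₃ → continue (weaken I₃ λ { Uz (inj₂ (τz≡u , _)) →
                                            contradiction (transpose-to-i u w τz≡u) (proj₂ (remove-sound U₁ w Uz)) })
                    (Suitable⁺-remove² Uv (Slot.Uv s₂′) (Slot.part-v sᵢ) part-w good₂)
                    (suc-injective (trans (sumF-#pending-remove (Slot.Uv s₂′)) total₁)))

  play : ∀ e → Playable e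
  play = <-rec Playable next-rounds
    where
      next-rounds : ∀ e → WfRec _<_ Playable e → Playable e
      next-rounds zero           _ {U = U} I good total =
        contradiction (subst (2 ≤_) total (Suitable⁺⇒sumF≥2 (#pending U) good)) λ ()
      next-rounds (suc zero)     _ {U = U} I good total =
        contradiction (subst (2 ≤_) total (Suitable⁺⇒sumF≥2 (#pending U) good)) λ { (s≤s ()) }
      next-rounds (suc (suc e)) IH {c} {φ} {U} I good total with plan (#pending U) good
      ... | offerPair _ _ i≢j pos-i pos-j good-i good-j =
        offer-pair (IH ≤-refl) I total i≢j pos-i pos-j good-i good-j
      ... | forceThenOfferPair _ _ _ i≢j₁ i≢j₂ j₁≢j₂ pos-i pos-j₁ pos-j₂ good₁ good₂ =
        force-then-offer-pair (IH (s≤s (n≤1+n e))) I total i≢j₁ i≢j₂ j₁≢j₂ pos-i pos-j₁ pos-j₂ good₁ good₂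
      ... | fourSingletons ≤1 four =
        subst (λ t → Forced (suc t) c) (trans (sym four) total) (four-singletons I ≤1 four)
      ... | pairAndThreeSingletons i two ≤1 five =
        subst (λ t → Forced (suc t) c) (trans (sym five) total) (pair-and-three-singletons I i two ≤1 five)

  root? : Decidable (IsRoot F)
  root? v with parent F v
  ... | nothing = yes refl
  ... | just _  = no λ ()

  initial-invariant : (∀ r r′ → IsRoot F r → IsRoot F r′ → ρ r ≡ ρ r′ → r ≡ r′) →
    Σ (Fin n → Fin n) λ φ → Invariant initial φ (λ v → is-just (parent F v)) None
  initial-invariant ρ-injective with extend-injection root? ρ (λ {r} {r′} → ρ-injective r r′)
  ... | φ , φ-injective , φ-ρ = φ , record
    { symmetric = λ _ _ → refl ; loopless = λ _ → refl ; injective = φ-injective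
    ; roots-placed = φ-ρ
    ; roots-embedded = λ r root → cong is-just root
    ; embedded-closed = λ Ux px → contradiction (trans (sym (cong is-just px)) Ux) λ ()
    ; admissible = λ _ _ → Admissible-free
    ; tree-red = λ Ux px → contradiction (trans (sym (cong is-just px)) Ux) λ ()
    ; roots-free = λ _ _ _ → refl
    ; pending-allowed = λ _ _ free≢free → contradiction refl free≢free }

lemma3p16 : ∀ {n ℓ : ℕ} (F : ForestTuple n ℓ) → 0 < eF F → Suitable F →
    (ρ : Fin n → Fin n) →
    (∀ r r' → IsRoot F r → IsRoot F r' → ρ r ≡ ρ r' → r ≡ r') →
    Forces (Goal F ρ) (suc (eF F)) initial
lemma3p16 F e>0 suitable ρ ρ-injective =
  Game.play F ρ (eF F) (proj₂ (Game.initial-invariant F ρ ρ-injective)) (suitable , maxF-pos (eᵢ F) e>0) refl
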